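{- For every integer $k\geq 1$, there exists an $n$-vertex graph $G$ with vertices $s,t$ such that the diameter of the graph $k\text{ -SPR}(G,s,t)$ is $2^{\Omega(n/k)}$.
   Context: All graphs are finite, simple, undirected, unweighted. For a positive integer $k$, a $k$-SPR reconfiguration step transforms an $s$–$t$ shortest path $(v_1,\ldots,v_r)$ into another $s$–$t$ shortest path by replacing at most $k$ contiguous vertices by new vertices. The reconfiguration graph $k\text{ -SPR}(G,s,t)$ has one vertex for each $s$–$t$ shortest path in $G$, two being adjacent iff one can be obtained from the other by a single $k$-SPR reconfiguration step. Its diameter is its graph diameter. -}

module Defs where

open import Data.Nat using (ℕ; zero; suc; _+_; _*_; _^_; _≤_)
open import Data.Fin using (Fin)
open import Data.Bool using (Bool; true; false)
open import Data.List using (List; []; _∷_; _++_; length)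
open import Data.Product using (Σ; ∃; ∃-syntax; _×_; _,_)
open import Relation.Binary.PropositionalEquality using (_≡_; _≢_)

record Graph (n : ℕ) : Set where
  field
    adj   : Fin n → Fin n → Bool
    sym   : ∀ u v → adj u v ≡ adj v u
    irrefl : ∀ v → adj v v ≡ false

open Graph public

data Chain {n : ℕ} (G : Graph n) : List (Fin n) → Set where
  chain-[] : Chain G []
  chain-1  : ∀ v → Chain G (v ∷ [])
  chain-∷  : ∀ u v vs → adj G u v ≡ true → Chain G (v ∷ vs) → Chain G (u ∷ v ∷ vs)

lastOr : {A : Set} → A → List A → A
lastOr d []       = d
lastOr d (x ∷ xs) = lastOr x xs

IsWalk : {n : ℕ} → Graph n → Fin n → Fin n → List (Fin n) → Set
IsWalk G s t [] = Data.Empty.⊥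
  where import Data.Empty
IsWalk G s t (v ∷ vs) = (v ≡ s) × (lastOr v vs ≡ t) × Chain G (v ∷ vs)

-- An s–t shortest path: an s–t walk with a minimum number of vertices
-- (a minimum-length walk is automatically a path).
IsShortestPath : {n : ℕ} → Graph n → Fin n → Fin n → List (Fin n) → Set
IsShortestPath G s t P =
  IsWalk G s t P × (∀ Q → IsWalk G s t Q → length P ≤ length Q)

-- One k-SPR reconfiguration step: Q differs from P by replacing a
-- contiguous block of at most k vertices (P ≠ Q: the reconfiguration
-- graph is simple).
SPRStep : {n : ℕ} → ℕ → List (Fin n) → List (Fin n) → Set
SPRStep {n} k P Q =
  (P ≢ Q) ×
  ∃[ A ] ∃[ B ] ∃[ B′ ] ∃[ C ]
    ((P ≡ A ++ B ++ C) × (Q ≡ A ++ B′ ++ C) × (length B ≤ k) × (length B′ ≤ k))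

SPRAdj : {n : ℕ} → Graph n → Fin n → Fin n → ℕ → List (Fin n) → List (Fin n) → Set
SPRAdj G s t k P Q =
  IsShortestPath G s t P × IsShortestPath G s t Q × SPRStep k P Q

data SPRWalk {n : ℕ} (G : Graph n) (s t : Fin n) (k : ℕ)
     : List (Fin n) → List (Fin n) → ℕ → Set where
  walk-refl : ∀ P → IsShortestPath G s t P → SPRWalk G s t k P P zero
  walk-step : ∀ P Q R m → SPRAdj G s t k P Q → SPRWalk G s t k Q R m →
              SPRWalk G s t k P R (suc m)

SPRConnected : {n : ℕ} → Graph n → Fin n → Fin n → ℕ → Set
SPRConnected G s t k =
  ∀ P Q → IsShortestPath G s t P → IsShortestPath G s t Q →
    ∃[ m ] SPRWalk G s t k P Q m

module Submission where

open import Defs hiding (sym)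
open import Data.Nat
open import Data.Nat.Properties
open import Data.Nat.DivMod
open import Data.Nat.Tactic.RingSolver using (solve-∀)
open import Data.Bool using (Bool; true; false; T; _∧_; _∨_; if_then_else_; not)
open import Data.Bool.Properties using (∧-comm; ∨-comm; ∧-assoc; ∧-zeroʳ)
open import Data.Empty using (⊥-elim)
open import Data.Sum using (_⊎_; inj₁; inj₂)
open import Data.Product using (Σ; ∃-syntax; _×_; _,_; proj₁; proj₂)
open import Data.Fin using (Fin; toℕ; fromℕ<)
open import Data.Fin.Properties using (toℕ-fromℕ<; toℕ-injective)
import Data.Fin.Properties as Fin
import Data.List.Properties as List
open import Data.List using (List; []; _∷_; _++_; length)
open import Relation.Binary.PropositionalEquality
open import Relation.Nullary using (¬_; yes; no; Dec)
open import Relation.Nullary.Decidable using (decidable-stable)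

-- The graph is layered: every s–t shortest path picks one label on each level.  The inner levels
-- form 2h + 1 blocks of k levels on which a shortest path cannot change its label, so shortest
-- paths are words of 2h + 1 labels (states 0–3 in even blocks, connectors in odd ones) subject to
-- a compatibility condition between neighbours, and a k-SPR step rewrites at most one block.
-- Through the hinge connectors the state i + 1 can only go 0 → 1 → 2 → 3 while state i is 3, 0
-- and 3 respectively, so raising state i + 1 from 0 to 3 makes state i go from 3 to 0 and back:
-- it costs at least twice as much as raising state i, i.e. 2^h steps for the last state.  The same
-- moves, organised recursively, turn every shortest path into the all-0 word, so the
-- reconfiguration graph is connected.  The construction uses about 22 h k of the n vertices (the
-- others stay isolated), so h can be taken to be n / 44k, and then 2^h ≥ 2^(n / 88k).

module _ {A : Set} where
  tabulateFrom : (ℕ → A) → ℕ → ℕ → List A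
  tabulateFrom f a zero    = []
  tabulateFrom f a (suc c) = f a ∷ tabulateFrom f (suc a) c

  lookupOr : A → List A → ℕ → A
  lookupOr d []       j       = d
  lookupOr d (x ∷ xs) zero    = x
  lookupOr d (x ∷ xs) (suc j) = lookupOr d xs j

  length-tabulateFrom : ∀ f a c → length (tabulateFrom f a c) ≡ c
  length-tabulateFrom f a zero    = refl
  length-tabulateFrom f a (suc c) = cong suc (length-tabulateFrom f (suc a) c)

  tabulateFrom-+ : ∀ f a b c → tabulateFrom f a (b + c) ≡ tabulateFrom f a b ++ tabulateFrom f (a + b) c
  tabulateFrom-+ f a zero    c = cong (λ x → tabulateFrom f x c) (sym (+-identityʳ a))
  tabulateFrom-+ f a (suc b) c = cong (f a ∷_) (trans (tabulateFrom-+ f (suc a) b c)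
    (cong (λ x → tabulateFrom f (suc a) b ++ tabulateFrom f x c) (sym (+-suc a b))))

  lookupOr-tabulateFrom : ∀ d f a c j → j < c → lookupOr d (tabulateFrom f a c) j ≡ f (a + j)
  lookupOr-tabulateFrom d f a (suc c) zero    _         = cong f (sym (+-identityʳ a))
  lookupOr-tabulateFrom d f a (suc c) (suc j) (s≤s j<c) =
    trans (lookupOr-tabulateFrom d f (suc a) c j j<c) (cong f (sym (+-suc a j)))

  tabulateFrom-cong : ∀ f g a c → (∀ j → a ≤ j → j < a + c → f j ≡ g j) →
                      tabulateFrom f a c ≡ tabulateFrom g a c
  tabulateFrom-cong f g a zero    f≗g = refl
  tabulateFrom-cong f g a (suc c) f≗g = cong₂ _∷_ (f≗g a ≤-refl (m<m+n a z<s))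
    (tabulateFrom-cong f g (suc a) c λ j a<j j<a+c →
       f≗g j (≤-trans (n≤1+n a) a<j) (subst (j <_) (sym (+-suc a c)) j<a+c))

  lookupOr-ext : ∀ d (P Q : List A) → length P ≡ length Q →
                 (∀ j → j < length P → lookupOr d P j ≡ lookupOr d Q j) → P ≡ Q
  lookupOr-ext d []      []      _   _   = refl
  lookupOr-ext d (x ∷ P) (y ∷ Q) len eq = cong₂ _∷_ (eq 0 z<s)
    (lookupOr-ext d P Q (suc-injective len) (λ j j< → eq (suc j) (s≤s j<)))

  lookupOr-++ˡ : ∀ d (P Q : List A) j → j < length P → lookupOr d (P ++ Q) j ≡ lookupOr d P j
  lookupOr-++ˡ d (x ∷ P) Q zero    _       = refl
  lookupOr-++ˡ d (x ∷ P) Q (suc j) (s≤s p) = lookupOr-++ˡ d P Q j p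

  lookupOr-++ʳ : ∀ d (P Q : List A) j → lookupOr d (P ++ Q) (length P + j) ≡ lookupOr d Q j
  lookupOr-++ʳ d []      Q j = refl
  lookupOr-++ʳ d (x ∷ P) Q j = lookupOr-++ʳ d P Q j

  lastOr-tabulateFrom : ∀ f x a c → lastOr x (tabulateFrom f a (suc c)) ≡ f (a + c)
  lastOr-tabulateFrom f x a zero    = cong f (sym (+-identityʳ a))
  lastOr-tabulateFrom f x a (suc c) = trans (lastOr-tabulateFrom f (f a) (suc a) c) (cong f (sym (+-suc a c)))

∧-true : ∀ {x y} → x ∧ y ≡ true → x ≡ true × y ≡ true
∧-true {true} y≡ = refl , y≡

true-∧ : ∀ {x y} → x ≡ true → y ≡ true → x ∧ y ≡ true
true-∧ refl refl = refl

∨-true : ∀ {x y} → x ∨ y ≡ true → x ≡ true ⊎ y ≡ true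
∨-true {true}  _  = inj₁ refl
∨-true {false} y≡ = inj₂ y≡

≡ᵇ-true : ∀ {a b} → (a ≡ᵇ b) ≡ true → a ≡ b
≡ᵇ-true {a} {b} e = ≡ᵇ⇒≡ a b (subst T (sym e) _)

≡ᵇ-refl : ∀ a → (a ≡ᵇ a) ≡ true
≡ᵇ-refl zero    = refl
≡ᵇ-refl (suc a) = ≡ᵇ-refl a

≡ᵇ-false : ∀ {a b} → a ≢ b → (a ≡ᵇ b) ≡ false
≡ᵇ-false {a} {b} a≢b with a ≡ᵇ b in eq
... | true  = ⊥-elim (a≢b (≡ᵇ-true eq))
... | false = refl

<ᵇ-true : ∀ {a b} → (a <ᵇ b) ≡ true → a < b
<ᵇ-true {a} {b} e = <ᵇ⇒< a b (subst T (sym e) _)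

<⇒<ᵇ-true : ∀ {a b} → a < b → (a <ᵇ b) ≡ true
<⇒<ᵇ-true {zero}  {suc b} _         = refl
<⇒<ᵇ-true {suc a} {suc b} (s≤s a<b) = <⇒<ᵇ-true a<b

≮⇒<ᵇ-false : ∀ {a b} → ¬ a < b → (a <ᵇ b) ≡ false
≮⇒<ᵇ-false {a} {b} ¬a<b with a <ᵇ b in eq
... | true  = ⊥-elim (¬a<b (<ᵇ-true eq))
... | false = refl

<ᵇ-irrefl : ∀ a → (a <ᵇ a) ≡ false
<ᵇ-irrefl zero    = refl
<ᵇ-irrefl (suc a) = <ᵇ-irrefl a

if-true : ∀ {A : Set} {b} {x y : A} → b ≡ true → (if b then x else y) ≡ x
if-true refl = refl

if-false : ∀ {A : Set} {b} {x y : A} → b ≡ false → (if b then x else y) ≡ y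
if-false refl = refl

even : ℕ → Bool
even zero          = true
even (suc zero)    = false
even (suc (suc g)) = even g

even-suc : ∀ g → even (suc g) ≡ not (even g)
even-suc zero          = refl
even-suc (suc zero)    = refl
even-suc (suc (suc g)) = even-suc g

even-or-odd : ∀ g → even g ≡ true ⊎ even g ≡ false
even-or-odd g with even g
... | true  = inj₁ refl
... | false = inj₂ refl

double : ℕ → ℕ
double zero    = zero
double (suc i) = suc (suc (double i))

double≡+ : ∀ i → double i ≡ i + i
double≡+ zero    = refl
double≡+ (suc i) = cong suc (trans (cong suc (double≡+ i)) (sym (+-suc i i)))

double-mono-≤ : ∀ {i j} → i ≤ j → double i ≤ double j
double-mono-≤ z≤n     = z≤n
double-mono-≤ (s≤s p) = s≤s (s≤s (double-mono-≤ p))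

even-double : ∀ i → even (double i) ≡ true
even-double zero    = refl
even-double (suc i) = even-double i

even-suc-double : ∀ i → even (suc (double i)) ≡ false
even-suc-double i = trans (even-suc (double i)) (cong not (even-double i))

-- Labels 0–3 are the states; 4–10 are connectors.  The connector 4 + a ("pin a")
-- forces the state on its right to be a and accepts any state on its left.  The
-- connector 8 + b ("hinge b", b < 3) accepts the states b and b + 1 on its right but
-- only the state hingeLeft b on its left.

width : ℕ
width = 11

isState : ℕ → Bool
isState l = l <ᵇ 4

isConnector : ℕ → Bool
isConnector l = (3 <ᵇ l) ∧ (l <ᵇ width)

leftOK : ℕ → ℕ → Bool
leftOK 8  a = a ≡ᵇ 3
leftOK 9  a = a ≡ᵇ 0
leftOK 10 a = a ≡ᵇ 3
leftOK c  a = isState a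

rightOK : ℕ → ℕ → Bool
rightOK 4  a = a ≡ᵇ 0
rightOK 5  a = a ≡ᵇ 1
rightOK 6  a = a ≡ᵇ 2
rightOK 7  a = a ≡ᵇ 3
rightOK 8  a = (a ≡ᵇ 0) ∨ (a ≡ᵇ 1)
rightOK 9  a = (a ≡ᵇ 1) ∨ (a ≡ᵇ 2)
rightOK 10 a = (a ≡ᵇ 2) ∨ (a ≡ᵇ 3)
rightOK c  a = false

pin hinge : ℕ → ℕ
pin a   = 4 + a
hinge b = 8 + b

hingeLeft : ℕ → ℕ
hingeLeft 1 = 0
hingeLeft _ = 3

admissible : ℕ → ℕ → Bool
admissible g l = if even g then isState l else isConnector l

compatible : ℕ → ℕ → ℕ → Bool
compatible g a b =
  if even g then isState a ∧ (leftOK b a ∧ isConnector b)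
            else isConnector a ∧ (rightOK a b ∧ isState b)

isState-< : ∀ {l} → isState l ≡ true → l < 4
isState-< = <ᵇ-true

isState-<width : ∀ {l} → isState l ≡ true → l < width
isState-<width e = ≤-trans (isState-< e) (s≤s (s≤s (s≤s (s≤s z≤n))))

isConnector-<width : ∀ {l} → isConnector l ≡ true → l < width
isConnector-<width {l} e with ∧-true {3 <ᵇ l} e
... | _ , l<w = <ᵇ-true l<w

admissible-<width : ∀ g {l} → admissible g l ≡ true → l < width
admissible-<width g e with even g
... | true  = isState-<width e
... | false = isConnector-<width e

admissible-even : ∀ {g a} → even g ≡ true → admissible g a ≡ isState a
admissible-even e = if-true e

admissible-odd : ∀ {g a} → even g ≡ false → admissible g a ≡ isConnector a
admissible-odd e = if-false e

∧³-true : ∀ x y {z} → x ∧ (y ∧ z) ≡ true → x ≡ true × y ≡ true × z ≡ true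
∧³-true true true e = refl , refl , e

compatible-even⁻ : ∀ g {a b} → even g ≡ true → compatible g a b ≡ true →
                   isState a ≡ true × leftOK b a ≡ true × isConnector b ≡ true
compatible-even⁻ g {a} {b} e c = ∧³-true (isState a) (leftOK b a) (trans (sym (if-true e)) c)

compatible-odd⁻ : ∀ g {a b} → even g ≡ false → compatible g a b ≡ true →
                  isConnector a ≡ true × rightOK a b ≡ true × isState b ≡ true
compatible-odd⁻ g {a} {b} e c = ∧³-true (isConnector a) (rightOK a b) (trans (sym (if-false e)) c)

compatible-even⁺ : ∀ g a b → even g ≡ true → isState a ≡ true → leftOK b a ≡ true →
                   isConnector b ≡ true → compatible g a b ≡ true
compatible-even⁺ g a b e sa l cb = trans (if-true e) (true-∧ sa (true-∧ l cb))

compatible-odd⁺ : ∀ g a b → even g ≡ false → isConnector a ≡ true → rightOK a b ≡ true →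
                  isState b ≡ true → compatible g a b ≡ true
compatible-odd⁺ g a b e ca r sb = trans (if-false e) (true-∧ ca (true-∧ r sb))

compatible-<width : ∀ g {a b} → compatible g a b ≡ true → a < width × b < width
compatible-<width g {a} {b} c with even-or-odd g
... | inj₁ e = let sa , _ , cb = compatible-even⁻ g {a} {b} e c in isState-<width sa , isConnector-<width cb
... | inj₂ e = let ca , _ , sb = compatible-odd⁻ g {a} {b} e c in isConnector-<width ca , isState-<width sb

compatible⇒admissibleˡ : ∀ g {a b} → compatible g a b ≡ true → admissible g a ≡ true
compatible⇒admissibleˡ g {a} {b} c with even-or-odd g
... | inj₁ e = let sa , _ = compatible-even⁻ g {a} {b} e c in trans (admissible-even {g} {a} e) sa
... | inj₂ e = let ca , _ = compatible-odd⁻ g {a} {b} e c in trans (admissible-odd {g} {a} e) ca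

isState⁺ : ∀ {a} → a < 4 → isState a ≡ true
isState⁺ = <⇒<ᵇ-true

pin-isConnector : ∀ a → isState a ≡ true → isConnector (pin a) ≡ true
pin-isConnector 0 _ = refl
pin-isConnector 1 _ = refl
pin-isConnector 2 _ = refl
pin-isConnector 3 _ = refl
pin-isConnector (suc (suc (suc (suc a)))) ()

pin-rightOK : ∀ a → isState a ≡ true → rightOK (pin a) a ≡ true
pin-rightOK 0 _ = refl
pin-rightOK 1 _ = refl
pin-rightOK 2 _ = refl
pin-rightOK 3 _ = refl
pin-rightOK (suc (suc (suc (suc a)))) ()

pin-leftOK : ∀ a x → isState a ≡ true → leftOK (pin a) x ≡ isState x
pin-leftOK 0 x _ = refl
pin-leftOK 1 x _ = refl
pin-leftOK 2 x _ = refl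
pin-leftOK 3 x _ = refl
pin-leftOK (suc (suc (suc (suc a)))) x ()

isState-hingeLeft : ∀ b → isState (hingeLeft b) ≡ true
isState-hingeLeft 0             = refl
isState-hingeLeft 1             = refl
isState-hingeLeft (suc (suc b)) = refl

hinge-isConnector : ∀ b → b < 3 → isConnector (hinge b) ≡ true
hinge-isConnector 0 _ = refl
hinge-isConnector 1 _ = refl
hinge-isConnector 2 _ = refl
hinge-isConnector (suc (suc (suc b))) (s≤s (s≤s (s≤s ())))

hinge-rightOK : ∀ b → b < 3 → rightOK (hinge b) b ≡ true × rightOK (hinge b) (suc b) ≡ true
hinge-rightOK 0 _ = refl , refl
hinge-rightOK 1 _ = refl , refl
hinge-rightOK 2 _ = refl , refl
hinge-rightOK (suc (suc (suc b))) (s≤s (s≤s (s≤s ())))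

hinge-leftOK : ∀ b → b < 3 → leftOK (hinge b) (hingeLeft b) ≡ true
hinge-leftOK 0 _ = refl
hinge-leftOK 1 _ = refl
hinge-leftOK 2 _ = refl
hinge-leftOK (suc (suc (suc b))) (s≤s (s≤s (s≤s ())))

leftOK-hinge : ∀ b {d} → b < 3 → leftOK (hinge b) d ≡ true → d ≡ hingeLeft b
leftOK-hinge 0 _ e = ≡ᵇ-true e
leftOK-hinge 1 _ e = ≡ᵇ-true e
leftOK-hinge 2 _ e = ≡ᵇ-true e
leftOK-hinge (suc (suc (suc b))) (s≤s (s≤s (s≤s ()))) _

adjacent-pair : ∀ x {a b} → x < 3 → a < b →
                (a ≡ᵇ x) ∨ (a ≡ᵇ suc x) ≡ true → (b ≡ᵇ x) ∨ (b ≡ᵇ suc x) ≡ true →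
                a < 3 × hinge x ≡ hinge a × b ≡ suc a
adjacent-pair x {a} {b} x<3 a<b ra rb with ∨-true {a ≡ᵇ x} ra | ∨-true {b ≡ᵇ x} rb
... | inj₁ a≡ | inj₂ b≡ rewrite ≡ᵇ-true {a} a≡ | ≡ᵇ-true {b} b≡ = x<3 , refl , refl
... | inj₁ a≡ | inj₁ b≡ rewrite ≡ᵇ-true {a} a≡ | ≡ᵇ-true {b} b≡ = ⊥-elim (<-irrefl refl a<b)
... | inj₂ a≡ | inj₁ b≡ rewrite ≡ᵇ-true {a} a≡ | ≡ᵇ-true {b} b≡ = ⊥-elim (<-asym a<b (n<1+n x))
... | inj₂ a≡ | inj₂ b≡ rewrite ≡ᵇ-true {a} a≡ | ≡ᵇ-true {b} b≡ = ⊥-elim (<-irrefl refl a<b)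

rightOK-twice⇒hinge : ∀ c {a b} → a < b → rightOK c a ≡ true → rightOK c b ≡ true →
              a < 3 × c ≡ hinge a × b ≡ suc a
rightOK-twice⇒hinge 4  a<b ra rb = ⊥-elim (<-irrefl (trans (≡ᵇ-true ra) (sym (≡ᵇ-true rb))) a<b)
rightOK-twice⇒hinge 5  a<b ra rb = ⊥-elim (<-irrefl (trans (≡ᵇ-true ra) (sym (≡ᵇ-true rb))) a<b)
rightOK-twice⇒hinge 6  a<b ra rb = ⊥-elim (<-irrefl (trans (≡ᵇ-true ra) (sym (≡ᵇ-true rb))) a<b)
rightOK-twice⇒hinge 7  a<b ra rb = ⊥-elim (<-irrefl (trans (≡ᵇ-true ra) (sym (≡ᵇ-true rb))) a<b)
rightOK-twice⇒hinge 8  a<b ra rb = adjacent-pair 0 (s≤s z≤n) a<b ra rb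
rightOK-twice⇒hinge 9  a<b ra rb = adjacent-pair 1 (s≤s (s≤s z≤n)) a<b ra rb
rightOK-twice⇒hinge 10 a<b ra rb = adjacent-pair 2 ≤-refl a<b ra rb
rightOK-twice⇒hinge 0 _ ()
rightOK-twice⇒hinge 1 _ ()
rightOK-twice⇒hinge 2 _ ()
rightOK-twice⇒hinge 3 _ ()
rightOK-twice⇒hinge (suc (suc (suc (suc (suc (suc (suc (suc (suc (suc (suc c))))))))))) _ ()

hinge-crossing : ∀ t c {a b d} → a < t → t ≤ b →
                 rightOK c a ≡ true → rightOK c b ≡ true → leftOK c d ≡ true →
                 a ≡ pred t × b ≡ t × d ≡ hingeLeft (pred t)
hinge-crossing t c {a} {b} {d} a<t t≤b ra rb ld
  with rightOK-twice⇒hinge c (<-≤-trans a<t t≤b) ra rb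
... | a<3 , refl , refl = cong pred (sym t≡) , sym t≡ ,
                          subst (λ x → d ≡ hingeLeft (pred x)) (sym t≡) (leftOK-hinge a a<3 ld)
  where
  t≡ : t ≡ suc a
  t≡ = ≤-antisym t≤b a<t

module Potential {n : ℕ} (G : Graph n) (φ : Fin n → ℕ)
                 (φ-adj : ∀ u v → adj G u v ≡ true → φ v ≤ suc (φ u)) where

  φ-lookupOr : ∀ d {v vs} → Chain G (v ∷ vs) → ∀ j → j ≤ length vs →
               φ (lookupOr d (v ∷ vs) j) ≤ φ v + j
  φ-lookupOr d c zero _ = m≤m+n _ 0
  φ-lookupOr d {v} (chain-∷ .v w ws e c) (suc j) (s≤s j≤) = begin
    φ (lookupOr d (w ∷ ws) j) ≤⟨ φ-lookupOr d c j j≤ ⟩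
    φ w + j                   ≤⟨ +-monoˡ-≤ j (φ-adj v w e) ⟩
    suc (φ v) + j             ≡⟨ sym (+-suc (φ v) j) ⟩
    φ v + suc j               ∎
    where open ≤-Reasoning

  φ-lastOr : ∀ {v vs} → Chain G (v ∷ vs) → φ (lastOr v vs) ≤ φ v + length vs
  φ-lastOr (chain-1 v) = m≤m+n _ 0
  φ-lastOr {v} {w ∷ ws} (chain-∷ .v .w .ws e c) = begin
    φ (lastOr w ws)   ≤⟨ φ-lastOr c ⟩
    φ w + length ws   ≤⟨ +-monoˡ-≤ (length ws) (φ-adj v w e) ⟩
    suc (φ v) + length ws ≡⟨ sym (+-suc (φ v) (length ws)) ⟩
    φ v + length (w ∷ ws) ∎
    where open ≤-Reasoning

  φ-lastOr-from : ∀ d {v vs} → Chain G (v ∷ vs) → ∀ j → j ≤ length vs →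
                  φ (lastOr v vs) ≤ φ (lookupOr d (v ∷ vs) j) + (length vs ∸ j)
  φ-lastOr-from d c zero _ = φ-lastOr c
  φ-lastOr-from d (chain-∷ v w ws e c) (suc j) (s≤s j≤) = φ-lastOr-from d c j j≤

  φ-lookupOr-exact : ∀ d {v vs} → Chain G (v ∷ vs) → φ v ≡ 0 → φ (lastOr v vs) ≡ length vs →
                     ∀ j → j ≤ length vs → φ (lookupOr d (v ∷ vs) j) ≡ j
  φ-lookupOr-exact d {v} {vs} c φv φlast j j≤ = ≤-antisym upper lower
    where
    x = φ (lookupOr d (v ∷ vs) j)
    upper : x ≤ j
    upper = subst (λ y → x ≤ y + j) φv (φ-lookupOr d c j j≤)
    lower : j ≤ x
    lower = +-cancelˡ-≤ (length vs ∸ j) j x (begin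
      (length vs ∸ j) + j ≡⟨ m∸n+n≡m j≤ ⟩
      length vs           ≡⟨ sym φlast ⟩
      φ (lastOr v vs)     ≤⟨ φ-lastOr-from d c j j≤ ⟩
      x + (length vs ∸ j) ≡⟨ +-comm x _ ⟩
      (length vs ∸ j) + x ∎)
      where open ≤-Reasoning

adj-lookupOr : ∀ {n} {G : Graph n} d {v vs} → Chain G (v ∷ vs) → ∀ j → suc j ≤ length vs →
               adj G (lookupOr d (v ∷ vs) j) (lookupOr d (v ∷ vs) (suc j)) ≡ true
adj-lookupOr d (chain-∷ v w ws e c) zero    _       = e
adj-lookupOr d (chain-∷ v w ws e c) (suc j) (s≤s p) = adj-lookupOr d c j p

Chain-tabulateFrom : ∀ {n} {G : Graph n} (f : ℕ → Fin n) a c →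
                     (∀ j → a ≤ j → j < a + c → adj G (f j) (f (suc j)) ≡ true) →
                     Chain G (tabulateFrom f a (suc c))
Chain-tabulateFrom f a zero    _ = chain-1 (f a)
Chain-tabulateFrom f a (suc c) e = chain-∷ (f a) (f (suc a)) _ (e a ≤-refl (m<m+n a z<s))
  (Chain-tabulateFrom f (suc a) c λ j a<j j<a+c →
     e j (≤-trans (n≤1+n a) a<j) (subst (j <_) (sym (+-suc a c)) j<a+c))

SPRStep-agree-outside : ∀ {n k} {P Q : List (Fin n)} d → SPRStep k P Q → length P ≡ length Q →
  ∃[ a ] (∀ j → j < a ⊎ a + k ≤ j → lookupOr d P j ≡ lookupOr d Q j)
SPRStep-agree-outside {k = k} {P} {Q} d (_ , A , B , B′ , C , refl , refl , B≤k , _) len =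
  length A , agree
  where
  |B|≡|B′| : length B ≡ length B′
  |B|≡|B′| = +-cancelʳ-≡ (length C) (length B) (length B′)
    (+-cancelˡ-≡ (length A) (length B + length C) (length B′ + length C) (begin
      length A + (length B + length C)    ≡⟨ cong (length A +_) (sym (List.length-++ B)) ⟩
      length A + length (B ++ C)          ≡⟨ sym (List.length-++ A) ⟩
      length (A ++ B ++ C)                ≡⟨ len ⟩
      length (A ++ B′ ++ C)               ≡⟨ List.length-++ A ⟩
      length A + length (B′ ++ C)         ≡⟨ cong (length A +_) (List.length-++ B′) ⟩
      length A + (length B′ + length C)   ∎))
    where open ≡-Reasoning
  lookup-C : ∀ B i → lookupOr d (A ++ B ++ C) (length A + (length B + i)) ≡ lookupOr d C i
  lookup-C B i = trans (lookupOr-++ʳ d A (B ++ C) (length B + i)) (lookupOr-++ʳ d B C i)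
  agree : ∀ j → j < length A ⊎ length A + k ≤ j →
          lookupOr d (A ++ B ++ C) j ≡ lookupOr d (A ++ B′ ++ C) j
  agree j (inj₁ j<A) = trans (lookupOr-++ˡ d A (B ++ C) j j<A) (sym (lookupOr-++ˡ d A (B′ ++ C) j j<A))
  agree j (inj₂ A+k≤j) = begin
    lookupOr d (A ++ B ++ C) j                                  ≡⟨ cong (lookupOr d (A ++ B ++ C)) j≡ ⟩
    lookupOr d (A ++ B ++ C) (length A + (length B + i))        ≡⟨ lookup-C B i ⟩
    lookupOr d C i                                              ≡⟨ sym (lookup-C B′ i) ⟩
    lookupOr d (A ++ B′ ++ C) (length A + (length B′ + i))      ≡⟨ cong (λ b → lookupOr d (A ++ B′ ++ C) (length A + (b + i))) (sym |B|≡|B′|) ⟩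
    lookupOr d (A ++ B′ ++ C) (length A + (length B + i))       ≡⟨ cong (lookupOr d (A ++ B′ ++ C)) (sym j≡) ⟩
    lookupOr d (A ++ B′ ++ C) j                                 ∎
    where
    open ≡-Reasoning
    A+B≤j : length A + length B ≤ j
    A+B≤j = ≤-trans (+-monoʳ-≤ (length A) B≤k) A+k≤j
    i = j ∸ (length A + length B)
    j≡ : j ≡ length A + (length B + i)
    j≡ = trans (sym (m+[n∸m]≡n A+B≤j)) (+-assoc (length A) (length B) i)

module Reconfiguration {n : ℕ} (G : Graph n) (s t : Fin n) (k : ℕ) where

  Reachable : List (Fin n) → List (Fin n) → Set
  Reachable P Q = ∃[ m ] SPRWalk G s t k P Q m

  SPRAdj-sym : ∀ {P Q} → SPRAdj G s t k P Q → SPRAdj G s t k Q P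
  SPRAdj-sym (spP , spQ , P≢Q , A , B , B′ , C , eP , eQ , lB , lB′) =
    spQ , spP , (λ e → P≢Q (sym e)) , A , B′ , B , C , eQ , eP , lB′ , lB

  SPRWalk-snoc : ∀ {P Q R m} → SPRWalk G s t k P Q m → SPRAdj G s t k Q R → SPRWalk G s t k P R (suc m)
  SPRWalk-snoc (walk-refl P _)         a@(_ , spR , _) = walk-step P _ _ 0 a (walk-refl _ spR)
  SPRWalk-snoc (walk-step P Q R m a w) b               = walk-step P Q _ (suc m) a (SPRWalk-snoc w b)

  SPRWalk-reverse : ∀ {P Q m} → SPRWalk G s t k P Q m → SPRWalk G s t k Q P m
  SPRWalk-reverse (walk-refl P sp)        = walk-refl P sp
  SPRWalk-reverse (walk-step P Q R m a w) = SPRWalk-snoc (SPRWalk-reverse w) (SPRAdj-sym a)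

  SPRWalk-++ : ∀ {P Q R m m′} → SPRWalk G s t k P Q m → SPRWalk G s t k Q R m′ →
               SPRWalk G s t k P R (m + m′)
  SPRWalk-++ (walk-refl P _)         w′ = w′
  SPRWalk-++ (walk-step P Q R m a w) w′ = walk-step P Q _ _ a (SPRWalk-++ w w′)

  Reachable-refl : ∀ {P} → IsShortestPath G s t P → Reachable P P
  Reachable-refl sp = 0 , walk-refl _ sp

  Reachable-trans : ∀ {P Q R} → Reachable P Q → Reachable Q R → Reachable P R
  Reachable-trans (m , w) (m′ , w′) = m + m′ , SPRWalk-++ w w′

  Reachable-sym : ∀ {P Q} → Reachable P Q → Reachable Q P
  Reachable-sym (m , w) = m , SPRWalk-reverse w

  Reachable-window : ∀ {P Q} A B B′ C → IsShortestPath G s t P → IsShortestPath G s t Q →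
                     P ≡ A ++ B ++ C → Q ≡ A ++ B′ ++ C → length B ≤ k → length B′ ≤ k →
                     Reachable P Q
  Reachable-window {P} {Q} A B B′ C spP spQ eP eQ lB lB′ with List.≡-dec Fin._≟_ P Q
  ... | yes refl = Reachable-refl spP
  ... | no P≢Q   = 1 , walk-step P Q Q 0 (spP , spQ , P≢Q , A , B , B′ , C , eP , eQ , lB , lB′)
                                      (walk-refl Q spQ)

  record Crossing (X : List (Fin n) → Set) (P Q : List (Fin n)) (m : ℕ) : Set where
    field
      before after : List (Fin n)
      m₁ m₂        : ℕ
      walk₁        : SPRWalk G s t k P before m₁
      edge         : SPRAdj G s t k before after
      walk₂        : SPRWalk G s t k after Q m₂
      ¬X-before    : ¬ X before
      X-after      : X after
      m≡           : m ≡ m₁ + suc m₂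

  first-crossing : ∀ {X} → (∀ P → Dec (X P)) → ∀ {P Q m} → SPRWalk G s t k P Q m →
                   ¬ X P → X Q → Crossing X P Q m
  first-crossing X? (walk-refl P _) ¬XP XQ = ⊥-elim (¬XP XQ)
  first-crossing X? (walk-step P Q R m a w) ¬XP XR with X? Q
  ... | yes XQ = record { walk₁ = walk-refl P (proj₁ a) ; edge = a ; walk₂ = w
                        ; ¬X-before = ¬XP ; X-after = XQ ; m≡ = refl }
  ... | no ¬XQ = record { walk₁ = walk-step P Q _ _ a (Crossing.walk₁ rest) ; edge = Crossing.edge rest
                        ; walk₂ = Crossing.walk₂ rest ; ¬X-before = Crossing.¬X-before rest
                        ; X-after = Crossing.X-after rest ; m≡ = cong suc (Crossing.m≡ rest) }
    where rest = first-crossing X? w ¬XQ XR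

window-covering-block : ∀ a b k′ → ¬ (suc b < a ⊎ a + suc k′ ≤ suc b) →
                        ¬ (suc (k′ + b) < a ⊎ a + suc k′ ≤ suc (k′ + b)) → a ≡ suc b
window-covering-block a b k′ first-inside last-inside = ≤-antisym a≤ (+-cancelʳ-≤ k′ (suc b) a (s≤s⁻¹ (begin
  suc (suc b + k′)   ≡⟨ cong suc (+-comm (suc b) k′) ⟩
  suc (k′ + suc b)   ≡⟨ cong suc (+-suc k′ b) ⟩
  suc (suc (k′ + b)) ≤⟨ ≰⇒> (λ le → last-inside (inj₂ le)) ⟩
  a + suc k′         ≡⟨ +-suc a k′ ⟩
  suc (a + k′)       ∎)))
  where
  open ≤-Reasoning
  a≤ : a ≤ suc b
  a≤ = ≮⇒≥ (λ lt → first-inside (inj₁ lt))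

update : (ℕ → ℕ) → ℕ → ℕ → ℕ → ℕ
update σ g l x = if x ≡ᵇ g then l else σ x

update-≡ : ∀ σ g l → update σ g l g ≡ l
update-≡ σ g l = if-true (≡ᵇ-refl g)

update-≢ : ∀ σ g l {x} → x ≢ g → update σ g l x ≡ σ x
update-≢ σ g l x≢g = if-false (≡ᵇ-false x≢g)

update-above : ∀ σ g l {x} → g < x → update σ g l x ≡ σ x
update-above σ g l g<x = update-≢ σ g l (>⇒≢ g<x)

-- The layered graph

divMod-unique : ∀ r q d .{{_ : NonZero d}} → r < d → (r + q * d) / d ≡ q × (r + q * d) % d ≡ r
divMod-unique r q d r<d = quotient , remainder
  where
  remainder : (r + q * d) % d ≡ r
  remainder = trans ([m+kn]%n≡m%n r q d) (m<n⇒m%n≡m r<d)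
  quotient : (r + q * d) / d ≡ q
  quotient = trans (+-distrib-/ r (q * d) (subst (_< d) (sym (trans (cong₂ _+_ (m<n⇒m%n≡m r<d) (m*n%n≡0 q d)) (+-identityʳ r))) r<d))
                   (cong₂ _+_ (m<n⇒m/n≡0 r<d) (m*n/n≡m q d))

depth : ℕ → ℕ → ℕ
depth k′ h = suc (double h) * suc k′

-- The graph has levels 0, …, depth + 1 with `width` vertices each; vertex l + j * width is
-- the vertex with label l on level j.  Level 0 and level depth + 1 only use label 0 (s and t).
-- Levels 1, …, depth form 2h + 1 blocks of k consecutive levels; inside a block every
-- shortest path keeps its label, so a path is described by one label per block.
module Layered (k′ h : ℕ) where
  k blocks L : ℕ
  k      = suc k′
  blocks = suc (double h)
  L      = depth k′ h

  -- edge from level 1 + r + g * k (the r-th level of block g) to the next level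
  blockEdge : ℕ → ℕ → ℕ → ℕ → Bool
  blockEdge g r l l′ =
    if suc r <ᵇ k then (l ≡ᵇ l′) ∧ (admissible g l ∧ (g <ᵇ blocks))
    else if suc g <ᵇ blocks then compatible g l l′
    else if suc g ≡ᵇ blocks then (l′ ≡ᵇ 0) ∧ isState l
    else false

  layerEdge : ℕ → ℕ → ℕ → Bool
  layerEdge zero    l l′ = (l ≡ᵇ 0) ∧ isState l′
  layerEdge (suc j) l l′ = blockEdge (j / k) (j % k) l l′

  levelOf labelOf : ℕ → ℕ
  levelOf a = a / width
  labelOf a = a % width

  inRange : ℕ → Bool
  inRange a = a <ᵇ suc (suc L) * width

  forwardEdge : ℕ → ℕ → Bool
  forwardEdge a b = (levelOf b ≡ᵇ suc (levelOf a)) ∧ layerEdge (levelOf a) (labelOf a) (labelOf b)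

  adjacency : ℕ → ℕ → Bool
  adjacency a b = inRange a ∧ (inRange b ∧ (forwardEdge a b ∨ forwardEdge b a))

  adjacency-sym : ∀ a b → adjacency a b ≡ adjacency b a
  adjacency-sym a b = begin
    inRange a ∧ (inRange b ∧ (forwardEdge a b ∨ forwardEdge b a)) ≡⟨ sym (∧-assoc (inRange a) (inRange b) _) ⟩
    (inRange a ∧ inRange b) ∧ (forwardEdge a b ∨ forwardEdge b a) ≡⟨ cong₂ _∧_ (∧-comm (inRange a) (inRange b)) (∨-comm (forwardEdge a b) (forwardEdge b a)) ⟩
    (inRange b ∧ inRange a) ∧ (forwardEdge b a ∨ forwardEdge a b) ≡⟨ ∧-assoc (inRange b) (inRange a) _ ⟩
    inRange b ∧ (inRange a ∧ (forwardEdge b a ∨ forwardEdge a b)) ∎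
    where open ≡-Reasoning

  adjacency-irrefl : ∀ a → adjacency a a ≡ false
  adjacency-irrefl a rewrite ≡ᵇ-false (<⇒≢ (n<1+n (levelOf a))) =
    trans (cong (inRange a ∧_) (∧-zeroʳ (inRange a))) (∧-zeroʳ (inRange a))

  graph : ∀ n → Graph n
  graph n = record { adj    = λ u v → adjacency (toℕ u) (toℕ v)
                   ; sym    = λ u v → adjacency-sym (toℕ u) (toℕ v)
                   ; irrefl = λ v → adjacency-irrefl (toℕ v) }

module Construction (k′ h n : ℕ) (room : suc (suc (depth k′ h)) * width ≤ n) where
  open Layered k′ h public

  G : Graph n
  G = graph n

  blockEdge-<width : ∀ g r {l l′} → blockEdge g r l l′ ≡ true → l < width × l′ < width
  blockEdge-<width g r {l} {l′} e with suc r <ᵇ k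
  ... | true  = let l≡ , ok , _ = ∧³-true (l ≡ᵇ l′) (admissible g l) e
                    l<w = admissible-<width g ok
                in l<w , subst (_< width) (≡ᵇ-true l≡) l<w
  ... | false with suc g <ᵇ blocks
  ...   | true = compatible-<width g e
  ...   | false with suc g ≡ᵇ blocks
  ...     | true  = let l′≡0 , sl = ∧-true {l′ ≡ᵇ 0} e
                    in isState-<width sl , subst (_< width) (sym (≡ᵇ-true l′≡0)) z<s
  blockEdge-<width g r () | false | false | false

  layerEdge-<width : ∀ j {l l′} → layerEdge j l l′ ≡ true → l < width × l′ < width
  layerEdge-<width zero    {l} e = let l≡0 , sl′ = ∧-true {l ≡ᵇ 0} e
                                   in subst (_< width) (sym (≡ᵇ-true l≡0)) z<s , isState-<width sl′
  layerEdge-<width (suc j) e = blockEdge-<width (j / k) (j % k) e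

  -- Out-of-range arguments are sent to the junk vertex 0; `room` makes every level ≤ L + 1 fit.
  toFin : ℕ → Fin n
  toFin a with a <? n
  ... | yes a<n = fromℕ< a<n
  ... | no  _   = fromℕ< (≤-trans z<s room)

  toℕ-toFin : ∀ {a} → a < n → toℕ (toFin a) ≡ a
  toℕ-toFin {a} a<n with a <? n
  ... | yes p = toℕ-fromℕ< p
  ... | no ¬p = ⊥-elim (¬p a<n)

  vertex : ℕ → ℕ → Fin n
  vertex j l = toFin (l + j * width)

  level label : Fin n → ℕ
  level u = levelOf (toℕ u)
  label u = labelOf (toℕ u)

  source target : Fin n
  source = vertex 0 0
  target = vertex (suc L) 0

  code<range : ∀ {j l} → j ≤ suc L → l < width → l + j * width < suc (suc L) * width
  code<range {j} {l} j≤ l< = <-≤-trans (+-monoˡ-< (j * width) l<) (*-monoˡ-≤ width (s≤s j≤))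

  toℕ-vertex : ∀ {j l} → j ≤ suc L → l < width → toℕ (vertex j l) ≡ l + j * width
  toℕ-vertex j≤ l< = toℕ-toFin (<-≤-trans (code<range j≤ l<) room)

  level-vertex : ∀ {j l} → j ≤ suc L → l < width → level (vertex j l) ≡ j
  level-vertex {j} {l} j≤ l< = trans (cong levelOf (toℕ-vertex j≤ l<)) (proj₁ (divMod-unique l j width l<))

  label-vertex : ∀ {j l} → j ≤ suc L → l < width → label (vertex j l) ≡ l
  label-vertex {j} {l} j≤ l< = trans (cong labelOf (toℕ-vertex j≤ l<)) (proj₂ (divMod-unique l j width l<))

  level-source : level source ≡ 0
  level-source = level-vertex z≤n z<s

  level-target : level target ≡ suc L
  level-target = level-vertex ≤-refl z<s

  inRange-vertex : ∀ {j l} → j ≤ suc L → l < width → inRange (toℕ (vertex j l)) ≡ true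
  inRange-vertex j≤ l< = subst (λ a → (a <ᵇ suc (suc L) * width) ≡ true) (sym (toℕ-vertex j≤ l<))
                                (<⇒<ᵇ-true (code<range j≤ l<))

  adj-vertex : ∀ {j l l′} → j ≤ L → layerEdge j l l′ ≡ true → adj G (vertex j l) (vertex (suc j) l′) ≡ true
  adj-vertex {j} {l} {l′} j≤L e =
    true-∧ (inRange-vertex j≤ l<) (true-∧ (inRange-vertex (s≤s j≤L) l′<) (forward-true (true-∧ up e′)))
    where
    l<  = proj₁ (layerEdge-<width j e)
    l′< = proj₂ (layerEdge-<width j e)
    j≤ = ≤-trans j≤L (n≤1+n L)
    u = vertex j l
    v = vertex (suc j) l′
    forward-true : ∀ {x y} → x ≡ true → x ∨ y ≡ true
    forward-true refl = refl
    up : (level v ≡ᵇ suc (level u)) ≡ true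
    up = subst₂ (λ a b → (a ≡ᵇ suc b) ≡ true) (sym (level-vertex (s≤s j≤L) l′<)) (sym (level-vertex j≤ l<))
                (≡ᵇ-refl (suc j))
    e′ : layerEdge (level u) (label u) (label v) ≡ true
    e′ = subst₂ (λ a b → layerEdge a b (label v) ≡ true) (sym (level-vertex j≤ l<)) (sym (label-vertex j≤ l<))
                (subst (λ c → layerEdge j l c ≡ true) (sym (label-vertex (s≤s j≤L) l′<)) e)

  Forward : Fin n → Fin n → Set
  Forward u v = level v ≡ suc (level u) × layerEdge (level u) (label u) (label v) ≡ true

  adj⇒Forward : ∀ {u v} → adj G u v ≡ true → Forward u v ⊎ Forward v u
  adj⇒Forward {u} {v} e with ∨-true (proj₂ (∧-true {inRange (toℕ v)} (proj₂ (∧-true {inRange (toℕ u)} e))))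
  ... | inj₁ f = inj₁ (let up , e′ = ∧-true {level v ≡ᵇ suc (level u)} f in ≡ᵇ-true up , e′)
  ... | inj₂ f = inj₂ (let up , e′ = ∧-true {level u ≡ᵇ suc (level v)} f in ≡ᵇ-true up , e′)

  level-adj : ∀ u v → adj G u v ≡ true → level v ≤ suc (level u)
  level-adj u v e with adj⇒Forward {u} {v} e
  ... | inj₁ (up , _) = ≤-reflexive up
  ... | inj₂ (up , _) = ≤-trans (n≤1+n _) (≤-trans (≤-reflexive (sym up)) (n≤1+n _))

  vertex-level-label : ∀ u → level u ≤ suc L → u ≡ vertex (level u) (label u)
  vertex-level-label u lv≤ = toℕ-injective (begin
    toℕ u                                 ≡⟨ m≡m%n+[m/n]*n (toℕ u) width ⟩
    label u + level u * width             ≡⟨ sym (toℕ-vertex lv≤ (m%n<n (toℕ u) width)) ⟩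
    toℕ (vertex (level u) (label u))      ∎)
    where open ≡-Reasoning

  blockEdge-inner : ∀ {g r l l′} → suc r < k → blockEdge g r l l′ ≡ (l ≡ᵇ l′) ∧ (admissible g l ∧ (g <ᵇ blocks))
  blockEdge-inner r<k = if-true (<⇒<ᵇ-true r<k)

  blockEdge-boundary : ∀ {g r l l′} → suc r ≡ k → suc g < blocks → blockEdge g r l l′ ≡ compatible g l l′
  blockEdge-boundary refl g<b = trans (if-false (<ᵇ-irrefl k)) (if-true (<⇒<ᵇ-true g<b))

  blockEdge-final : ∀ {g r l l′} → suc r ≡ k → suc g ≡ blocks → blockEdge g r l l′ ≡ (l′ ≡ᵇ 0) ∧ isState l
  blockEdge-final refl refl =
    trans (if-false (<ᵇ-irrefl k)) (trans (if-false (<ᵇ-irrefl blocks)) (if-true (≡ᵇ-refl blocks)))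

  layerEdge-block : ∀ {g r l l′} → r < k → layerEdge (suc (r + g * k)) l l′ ≡ blockEdge g r l l′
  layerEdge-block {g} {r} {l} {l′} r<k =
    cong₂ (λ x y → blockEdge x y l l′) (proj₁ (divMod-unique r g k r<k)) (proj₂ (divMod-unique r g k r<k))

  block-level<L : ∀ {g r} → r < k → g < blocks → r + g * k < L
  block-level<L {g} r<k g<b = <-≤-trans (+-monoˡ-< (g * k) r<k) (*-monoˡ-≤ k g<b)

  record BlockCoordinates (j : ℕ) : Set where
    constructor coordinates
    field
      blk off : ℕ
      off<k   : off < k
      blk<    : blk < blocks
      j≡      : j ≡ off + blk * k

  blockCoordinates : ∀ {j} → j < L → BlockCoordinates j
  blockCoordinates {j} j<L =
    coordinates (j / k) (j % k) (m%n<n j k) (m<n*o⇒m/o<n {j} {blocks} {k} j<L) (m≡m%n+[m/n]*n j k)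

  last-block : ∀ {g} → g < blocks → ¬ (suc g < blocks) → suc g ≡ blocks
  last-block g<b ¬sg<b = ≤-antisym g<b (≮⇒≥ ¬sg<b)

  ValidLabels : (ℕ → ℕ) → Set
  ValidLabels τ = ∀ j → j ≤ L → layerEdge j (τ j) (τ (suc j)) ≡ true

  pathOf : (ℕ → ℕ) → List (Fin n)
  pathOf τ = tabulateFrom (λ j → vertex j (τ j)) 0 (suc (suc L))

  ValidBlocks : (ℕ → ℕ) → Set
  ValidBlocks σ = (∀ g → g < blocks → admissible g (σ g) ≡ true) ×
                  (∀ g → suc g < blocks → compatible g (σ g) (σ (suc g)) ≡ true)

  expand : (ℕ → ℕ) → ℕ → ℕ
  expand σ zero    = 0
  expand σ (suc j) = if j <ᵇ L then σ (j / k) else 0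

  expand-block : ∀ σ {g r} → r < k → g < blocks → expand σ (suc (r + g * k)) ≡ σ g
  expand-block σ {g} {r} r<k g<b =
    trans (if-true (<⇒<ᵇ-true (block-level<L r<k g<b))) (cong σ (proj₁ (divMod-unique r g k r<k)))

  expand-last : ∀ σ → expand σ (suc L) ≡ 0
  expand-last σ = if-false (<ᵇ-irrefl L)

  blockPath : (ℕ → ℕ) → List (Fin n)
  blockPath σ = pathOf (expand σ)

  module _ (σ : ℕ → ℕ) (vσ : ValidBlocks σ) where
    admissible-σ : ∀ g → g < blocks → admissible g (σ g) ≡ true
    admissible-σ = proj₁ vσ

    compatible-σ : ∀ g → suc g < blocks → compatible g (σ g) (σ (suc g)) ≡ true
    compatible-σ = proj₂ vσ

    blockEdge-expand : ∀ g r → r < k → g < blocks →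
                       blockEdge g r (σ g) (expand σ (suc (suc (r + g * k)))) ≡ true
    blockEdge-expand g r r<k g<b with suc r <? k | suc g <? blocks
    ... | yes sr<k | _ = begin
      blockEdge g r (σ g) (expand σ (suc (suc r + g * k)))  ≡⟨ cong (blockEdge g r (σ g)) (expand-block σ sr<k g<b) ⟩
      blockEdge g r (σ g) (σ g)                             ≡⟨ blockEdge-inner {g} {r} {σ g} {σ g} sr<k ⟩
      (σ g ≡ᵇ σ g) ∧ (admissible g (σ g) ∧ (g <ᵇ blocks))   ≡⟨ true-∧ (≡ᵇ-refl (σ g)) (true-∧ (admissible-σ g g<b) (<⇒<ᵇ-true g<b)) ⟩
      true                                                  ∎
      where open ≡-Reasoning
    ... | no ¬sr<k | yes sg<b = begin
      blockEdge g r (σ g) (expand σ (suc (suc r + g * k)))  ≡⟨ cong (λ x → blockEdge g r (σ g) (expand σ (suc (x + g * k)))) sr≡k ⟩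
      blockEdge g r (σ g) (expand σ (suc (0 + suc g * k)))  ≡⟨ cong (blockEdge g r (σ g)) (expand-block σ z<s sg<b) ⟩
      blockEdge g r (σ g) (σ (suc g))                       ≡⟨ blockEdge-boundary {g} {r} {σ g} {σ (suc g)} sr≡k sg<b ⟩
      compatible g (σ g) (σ (suc g))                        ≡⟨ compatible-σ g sg<b ⟩
      true                                                  ∎
      where
      open ≡-Reasoning
      sr≡k = ≤-antisym r<k (≮⇒≥ ¬sr<k)
    ... | no ¬sr<k | no ¬sg<b = begin
      blockEdge g r (σ g) (expand σ (suc (suc r + g * k)))  ≡⟨ cong (λ x → blockEdge g r (σ g) (expand σ (suc x))) at-L ⟩
      blockEdge g r (σ g) (expand σ (suc L))                ≡⟨ cong (blockEdge g r (σ g)) (expand-last σ) ⟩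
      blockEdge g r (σ g) 0                                 ≡⟨ blockEdge-final {g} {r} {σ g} {0} sr≡k sg≡b ⟩
      isState (σ g)                                         ≡⟨ sym (admissible-even {g} {σ g} last-even) ⟩
      admissible g (σ g)                                    ≡⟨ admissible-σ g g<b ⟩
      true                                                  ∎
      where
      open ≡-Reasoning
      sr≡k = ≤-antisym r<k (≮⇒≥ ¬sr<k)
      sg≡b = last-block g<b ¬sg<b
      at-L : suc r + g * k ≡ L
      at-L = trans (cong (_+ g * k) sr≡k) (cong (_* k) sg≡b)
      last-even : even g ≡ true
      last-even = subst (λ x → even x ≡ true) (suc-injective (sym sg≡b)) (even-double h)

    ValidBlocks⇒ValidLabels : ValidLabels (expand σ)
    ValidBlocks⇒ValidLabels zero    _   = admissible-σ 0 z<s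
    ValidBlocks⇒ValidLabels (suc j) j<L with blockCoordinates j<L
    ... | coordinates g r r<k g<b refl = begin
      layerEdge (suc (r + g * k)) (expand σ (suc (r + g * k))) (expand σ (suc (suc (r + g * k))))
        ≡⟨ layerEdge-block {g} {r} {expand σ (suc (r + g * k))} {expand σ (suc (suc (r + g * k)))} r<k ⟩
      blockEdge g r (expand σ (suc (r + g * k))) (expand σ (suc (suc (r + g * k))))
        ≡⟨ cong (λ x → blockEdge g r x (expand σ (suc (suc (r + g * k))))) (expand-block σ r<k g<b) ⟩
      blockEdge g r (σ g) (expand σ (suc (suc (r + g * k))))
        ≡⟨ blockEdge-expand g r r<k g<b ⟩
      true ∎
      where open ≡-Reasoning

  open Potential G level level-adj

  layerEdge-last : ∀ {l l′} → layerEdge L l l′ ≡ true → l′ ≡ 0 × isState l ≡ true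
  layerEdge-last {l} {l′} e =
    let l′≡0 , sl = ∧-true {l′ ≡ᵇ 0} (trans (sym (blockEdge-final {double h} {k′} {l} {l′} refl refl))
                                            (trans (sym (layerEdge-block {double h} {k′} {l} {l′} ≤-refl)) e))
    in ≡ᵇ-true l′≡0 , sl

  walk-length : ∀ Q → IsWalk G source target Q → suc (suc L) ≤ length Q
  walk-length (v ∷ vs) (v≡s , last≡t , c) = s≤s (subst₂ _≤_
    (trans (cong level last≡t) level-target) (cong (_+ length vs) (trans (cong level v≡s) level-source))
    (φ-lastOr c))

  pathOf-shortest : ∀ τ → ValidLabels τ → IsShortestPath G source target (pathOf τ)
  pathOf-shortest τ valid = (starts , ends , chain) , minimal
    where
    f = λ j → vertex j (τ j)
    starts : f 0 ≡ source
    starts = cong (vertex 0) (≡ᵇ-true (proj₁ (∧-true {τ 0 ≡ᵇ 0} (valid 0 z≤n))))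
    ends : lastOr (f 0) (tabulateFrom f 1 (suc L)) ≡ target
    ends = trans (lastOr-tabulateFrom f (f 0) 1 L)
                 (cong (vertex (suc L)) (proj₁ (layerEdge-last {τ L} (valid L ≤-refl))))
    chain : Chain G (pathOf τ)
    chain = Chain-tabulateFrom f 0 (suc L) λ j _ j<sL → adj-vertex (s≤s⁻¹ j<sL) (valid j (s≤s⁻¹ j<sL))
    minimal : ∀ Q → IsWalk G source target Q → length (pathOf τ) ≤ length Q
    minimal Q w = subst (_≤ length Q) (sym (length-tabulateFrom f 0 (suc (suc L)))) (walk-length Q w)

  uniform : ℕ → ℕ → ℕ
  uniform a g = if even g then a else pin a

  uniform-valid : ∀ a → isState a ≡ true → ValidBlocks (uniform a)
  uniform-valid a sa = adm , comp
    where
    adm : ∀ g → g < blocks → admissible g (uniform a g) ≡ true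
    adm g _ with even g
    ... | true  = sa
    ... | false = pin-isConnector a sa
    comp : ∀ g → suc g < blocks → compatible g (uniform a g) (uniform a (suc g)) ≡ true
    comp g _ rewrite even-suc g with even g
    ... | true  = true-∧ sa (true-∧ (trans (pin-leftOK a a sa) sa) (pin-isConnector a sa))
    ... | false = true-∧ (pin-isConnector a sa) (true-∧ (pin-rightOK a sa) sa)

  shortest-length : ∀ P → IsShortestPath G source target P → length P ≡ suc (suc L)
  shortest-length P (walk , minimal) = ≤-antisym
    (subst (length P ≤_) (length-tabulateFrom f 0 (suc (suc L))) (minimal (pathOf τ) (proj₁ reference)))
    (walk-length P walk)
    where
    τ = expand (uniform 0)
    f = λ j → vertex j (τ j)
    reference : IsShortestPath G source target (pathOf τ)
    reference = pathOf-shortest τ (ValidBlocks⇒ValidLabels (uniform 0) (uniform-valid 0 refl))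

  level-shortest : ∀ P → IsShortestPath G source target P → ∀ j → j ≤ suc L → level (lookupOr source P j) ≡ j
  level-shortest (v ∷ vs) sp@((v≡s , last≡t , c) , _) j j≤ =
    φ-lookupOr-exact source c (trans (cong level v≡s) level-source)
      (trans (cong level last≡t) (trans level-target (sym |vs|))) j (subst (j ≤_) (sym |vs|) j≤)
    where
    |vs| : length vs ≡ suc L
    |vs| = suc-injective (shortest-length (v ∷ vs) sp)

  labelsOf : List (Fin n) → ℕ → ℕ
  labelsOf P j = label (lookupOr source P j)

  pathOf-labelsOf : ∀ P → IsShortestPath G source target P → P ≡ pathOf (labelsOf P)
  pathOf-labelsOf P sp = lookupOr-ext source P (pathOf (labelsOf P))
    (trans (shortest-length P sp) (sym (length-tabulateFrom f 0 (suc (suc L))))) same-entry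
    where
    f = λ j → vertex j (labelsOf P j)
    same-entry : ∀ j → j < length P → lookupOr source P j ≡ lookupOr source (pathOf (labelsOf P)) j
    same-entry j j<|P| = begin
      u                                       ≡⟨ vertex-level-label u (subst (_≤ suc L) (sym level≡) j≤) ⟩
      vertex (level u) (label u)              ≡⟨ cong (λ x → vertex x (label u)) level≡ ⟩
      vertex j (label u)                      ≡⟨ sym (lookupOr-tabulateFrom source f 0 (suc (suc L)) j j<) ⟩
      lookupOr source (pathOf (labelsOf P)) j ∎
      where
      open ≡-Reasoning
      u = lookupOr source P j
      j< = subst (j <_) (shortest-length P sp) j<|P|
      j≤ = s≤s⁻¹ j<
      level≡ = level-shortest P sp j j≤

  labelsOf-valid : ∀ P → IsShortestPath G source target P → ValidLabels (labelsOf P)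
  labelsOf-valid P@(v ∷ vs) sp@((_ , _ , c) , _) j j≤L = from-edge (adj⇒Forward {u} {w} (adj-lookupOr source c j j<))
    where
    u = lookupOr source P j
    w = lookupOr source P (suc j)
    j< = subst (suc j ≤_) (sym (suc-injective (shortest-length P sp))) (s≤s j≤L)
    from-edge : Forward u w ⊎ Forward w u → layerEdge j (label u) (label w) ≡ true
    from-edge (inj₁ (_ , e)) = subst (λ x → layerEdge x (label u) (label w) ≡ true) (level-shortest P sp j (≤-trans j≤L (n≤1+n L))) e
    from-edge (inj₂ (up , _)) = ⊥-elim (<⇒≢ (≤-trans (n<1+n j) (n≤1+n (suc j))) up′)
      where
      up′ : j ≡ suc (suc j)
      up′ = trans (sym (level-shortest P sp j (≤-trans j≤L (n≤1+n L))))
              (trans up (cong suc (level-shortest P sp (suc j) (s≤s j≤L))))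

  blockLabels : (ℕ → ℕ) → ℕ → ℕ
  blockLabels τ g = τ (suc (g * k))

  module _ (τ : ℕ → ℕ) (valid : ValidLabels τ) where

    blockEdge-τ : ∀ g r → r < k → g < blocks →
                  blockEdge g r (τ (suc (r + g * k))) (τ (suc (suc (r + g * k)))) ≡ true
    blockEdge-τ g r r<k g<b =
      trans (sym (layerEdge-block {g} {r} {τ (suc (r + g * k))} {τ (suc (suc (r + g * k)))} r<k))
            (valid (suc (r + g * k)) (block-level<L r<k g<b))

    constant-in-block : ∀ g r → r < k → g < blocks → τ (suc (r + g * k)) ≡ blockLabels τ g
    constant-in-block g zero    _   _   = refl
    constant-in-block g (suc r) sr<k g<b = begin
      τ (suc (suc r + g * k)) ≡⟨ sym (≡ᵇ-true (proj₁ (∧-true {τ (suc (r + g * k)) ≡ᵇ τ (suc (suc r + g * k))} inner))) ⟩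
      τ (suc (r + g * k))     ≡⟨ constant-in-block g r r<k g<b ⟩
      blockLabels τ g         ∎
      where
      open ≡-Reasoning
      r<k = <-trans (n<1+n r) sr<k
      inner = trans (sym (blockEdge-inner {g} {r} {τ (suc (r + g * k))} {τ (suc (suc r + g * k))} sr<k))
                    (blockEdge-τ g r r<k g<b)

    blockEdge-last : ∀ g → g < blocks → blockEdge g k′ (blockLabels τ g) (blockLabels τ (suc g)) ≡ true
    blockEdge-last g g<b = subst (λ x → blockEdge g k′ x (blockLabels τ (suc g)) ≡ true)
      (constant-in-block g k′ ≤-refl g<b) (blockEdge-τ g k′ ≤-refl g<b)

    blockLabels-valid : ValidBlocks (blockLabels τ)
    blockLabels-valid = adm , comp
      where
      comp : ∀ g → suc g < blocks → compatible g (blockLabels τ g) (blockLabels τ (suc g)) ≡ true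
      comp g sg<b = trans (sym (blockEdge-boundary {g} {k′} {blockLabels τ g} {blockLabels τ (suc g)} refl sg<b))
                          (blockEdge-last g (<-trans (n<1+n g) sg<b))
      adm : ∀ g → g < blocks → admissible g (blockLabels τ g) ≡ true
      adm g g<b with suc g <? blocks
      ... | yes sg<b = compatible⇒admissibleˡ g {blockLabels τ g} {blockLabels τ (suc g)} (comp g sg<b)
      ... | no ¬sg<b = begin
        admissible g (blockLabels τ g) ≡⟨ admissible-even {g} {blockLabels τ g} last-even ⟩
        isState (blockLabels τ g)      ≡⟨ proj₂ (∧-true {blockLabels τ (suc g) ≡ᵇ 0} final) ⟩
        true                           ∎
        where
        open ≡-Reasoning
        sg≡b = last-block g<b ¬sg<b
        last-even : even g ≡ true
        last-even = subst (λ x → even x ≡ true) (suc-injective (sym sg≡b)) (even-double h)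
        final = trans (sym (blockEdge-final {g} {k′} {blockLabels τ g} {blockLabels τ (suc g)} refl sg≡b))
                      (blockEdge-last g g<b)

    expand-blockLabels : ∀ j → j ≤ suc L → τ j ≡ expand (blockLabels τ) j
    expand-blockLabels zero    _  = ≡ᵇ-true (proj₁ (∧-true {τ 0 ≡ᵇ 0} (valid 0 z≤n)))
    expand-blockLabels (suc j) j≤ with j <? L
    ... | yes j<L with blockCoordinates j<L
    ...   | coordinates g r r<k g<b refl =
      trans (constant-in-block g r r<k g<b) (sym (expand-block (blockLabels τ) r<k g<b))
    expand-blockLabels (suc j) j≤ | no ¬j<L rewrite ≤-antisym (s≤s⁻¹ j≤) (≮⇒≥ ¬j<L) =
      trans (proj₁ (layerEdge-last {τ L} (valid L ≤-refl))) (sym (expand-last (blockLabels τ)))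

  pathOf-cong : ∀ {τ τ′} → (∀ j → j ≤ suc L → τ j ≡ τ′ j) → pathOf τ ≡ pathOf τ′
  pathOf-cong {τ} {τ′} τ≗τ′ = tabulateFrom-cong (λ j → vertex j (τ j)) (λ j → vertex j (τ′ j)) 0 (suc (suc L))
    λ j _ j< → cong (vertex j) (τ≗τ′ j (s≤s⁻¹ j<))

  blockPath-cong : ∀ {σ σ′} → (∀ g → g < blocks → σ g ≡ σ′ g) → blockPath σ ≡ blockPath σ′
  blockPath-cong {σ} {σ′} σ≗σ′ = pathOf-cong same
    where
    same : ∀ j → j ≤ suc L → expand σ j ≡ expand σ′ j
    same zero    _ = refl
    same (suc j) _ with j <? L
    ... | yes j<L = trans (if-true (<⇒<ᵇ-true j<L))
                    (trans (σ≗σ′ (j / k) (m<n*o⇒m/o<n {j} {blocks} {k} j<L)) (sym (if-true (<⇒<ᵇ-true j<L))))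
    ... | no ¬j<L = trans (if-false (≮⇒<ᵇ-false ¬j<L)) (sym (if-false (≮⇒<ᵇ-false ¬j<L)))

  blocksOf : List (Fin n) → ℕ → ℕ
  blocksOf P = blockLabels (labelsOf P)

  decode : ∀ P → IsShortestPath G source target P → P ≡ blockPath (blocksOf P) × ValidBlocks (blocksOf P)
  decode P sp = trans (pathOf-labelsOf P sp) (pathOf-cong (expand-blockLabels (labelsOf P) valid)) ,
                blockLabels-valid (labelsOf P) valid
    where valid = labelsOf-valid P sp

  blockPath-shortest : ∀ σ → ValidBlocks σ → IsShortestPath G source target (blockPath σ)
  blockPath-shortest σ vσ = pathOf-shortest (expand σ) (ValidBlocks⇒ValidLabels σ vσ)

  blocksOf-blockPath : ∀ σ → ValidBlocks σ → ∀ g → g < blocks → blocksOf (blockPath σ) g ≡ σ g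
  blocksOf-blockPath σ (adm , _) g g<b = begin
    label (lookupOr source (blockPath σ) (suc (g * k)))  ≡⟨ cong label (lookupOr-tabulateFrom source f 0 (suc (suc L)) (suc (g * k)) (s≤s (s≤s (<⇒≤ gk<L)))) ⟩
    label (vertex (suc (g * k)) (expand σ (suc (g * k)))) ≡⟨ label-vertex (s≤s (<⇒≤ gk<L)) (subst (_< width) (sym inside) (admissible-<width g (adm g g<b))) ⟩
    expand σ (suc (g * k))                               ≡⟨ inside ⟩
    σ g                                                  ∎
    where
    open ≡-Reasoning
    f = λ j → vertex j (expand σ j)
    gk<L : g * k < L
    gk<L = block-level<L {g} {0} z<s g<b
    inside : expand σ (suc (g * k)) ≡ σ g
    inside = expand-block σ {g} {0} z<s g<b

  open Reconfiguration G source target k public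

  -- A step rewrites a window of k consecutive levels; a differing block must fill it exactly.
  differing-block-is-window : ∀ {P Q} → SPRAdj G source target k P Q →
    ∃[ a ] (∀ g → g < blocks → blocksOf P g ≢ blocksOf Q g → a ≡ suc (g * k))
  differing-block-is-window {P} {Q} (spP , spQ , step) = a , window-start
    where
    outside-window = SPRStep-agree-outside source step (trans (shortest-length P spP) (sym (shortest-length Q spQ)))
    a = proj₁ outside-window
    agree = proj₂ outside-window
    agree-at : ∀ g r → r < k → g < blocks → (suc (r + g * k) < a ⊎ a + k ≤ suc (r + g * k)) →
               blocksOf P g ≡ blocksOf Q g
    agree-at g r r<k g<b outside = begin
      blocksOf P g                ≡⟨ sym (constant-in-block (labelsOf P) (labelsOf-valid P spP) g r r<k g<b) ⟩
      labelsOf P (suc (r + g * k)) ≡⟨ cong label (agree (suc (r + g * k)) outside) ⟩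
      labelsOf Q (suc (r + g * k)) ≡⟨ constant-in-block (labelsOf Q) (labelsOf-valid Q spQ) g r r<k g<b ⟩
      blocksOf Q g                ∎
      where open ≡-Reasoning
    window-start : ∀ g → g < blocks → blocksOf P g ≢ blocksOf Q g → a ≡ suc (g * k)
    window-start g g<b differ = window-covering-block a (g * k) k′
      (λ out → differ (agree-at g 0 z<s g<b out)) (λ out → differ (agree-at g k′ ≤-refl g<b out))

  one-block-changes : ∀ {P Q} → SPRAdj G source target k P Q → ∀ {g g′} → g < blocks → g′ < blocks →
                      blocksOf P g ≢ blocksOf Q g → g′ ≢ g → blocksOf P g′ ≡ blocksOf Q g′
  one-block-changes {P} {Q} adjPQ {g} {g′} g<b g′<b differ g′≢g =
    decidable-stable (blocksOf P g′ ≟ blocksOf Q g′) λ differ′ →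
      g′≢g (*-cancelʳ-≡ g′ g k (suc-injective (trans (sym (start g′ g′<b differ′)) (start g g<b differ))))
    where start = proj₂ (differing-block-is-window adjPQ)

  reachable-single-block : ∀ {σ σ′ g₀} → ValidBlocks σ → ValidBlocks σ′ → g₀ < blocks →
                           (∀ g → g ≢ g₀ → σ g ≡ σ′ g) → Reachable (blockPath σ) (blockPath σ′)
  reachable-single-block {σ} {σ′} {g₀} vσ vσ′ g₀<b σ≗σ′ =
    Reachable-window (front f) (window f) (window f′) (back f)
      (blockPath-shortest σ vσ) (blockPath-shortest σ′ vσ′) (split f)
      (trans (split f′) (cong₂ (λ x y → x ++ window f′ ++ y) (sym front≡) (sym back≡)))
      (≤-reflexive (length-tabulateFrom f a k)) (≤-reflexive (length-tabulateFrom f′ a k))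
    where
    a = suc (g₀ * k)
    rest = suc (suc L) ∸ (a + k)
    a+k≤ : a + k ≤ suc (suc L)
    a+k≤ = ≤-trans (s≤s (≤-reflexive (+-comm (g₀ * k) k))) (≤-trans (s≤s (*-monoˡ-≤ k g₀<b)) (n≤1+n _))
    f f′ : ℕ → Fin n
    f  j = vertex j (expand σ j)
    f′ j = vertex j (expand σ′ j)
    front window back : (ℕ → Fin n) → List (Fin n)
    front  φ = tabulateFrom φ 0 a
    window φ = tabulateFrom φ a k
    back   φ = tabulateFrom φ (a + k) rest
    split : ∀ φ → tabulateFrom φ 0 (suc (suc L)) ≡ front φ ++ window φ ++ back φ
    split φ = trans (cong (tabulateFrom φ 0) (sym (trans (sym (+-assoc a k rest)) (m+[n∸m]≡n a+k≤))))
                    (trans (tabulateFrom-+ φ 0 a (k + rest)) (cong (front φ ++_) (tabulateFrom-+ φ a k rest)))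
    outside : ∀ j → j < a ⊎ a + k ≤ j → expand σ j ≡ expand σ′ j
    outside zero    _   = refl
    outside (suc j) out = cong (λ x → if j <ᵇ L then x else 0) (σ≗σ′ (j / k) (other-block out))
      where
      other-block : suc j < a ⊎ a + k ≤ suc j → j / k ≢ g₀
      other-block (inj₁ sj<a) refl = <-irrefl refl (m<n*o⇒m/o<n {j} {j / k} {k} (s≤s⁻¹ sj<a))
      other-block (inj₂ a+k≤sj) refl = <-irrefl refl (subst (_≤ j / k) (m*n/n≡m (suc (j / k)) k)
        (/-monoˡ-≤ {suc (j / k) * k} {j} k (s≤s⁻¹ (subst (_≤ suc j) (cong suc (+-comm (j / k * k) k)) a+k≤sj))))
    front≡ : front f ≡ front f′
    front≡ = tabulateFrom-cong f f′ 0 a λ j _ j<a → cong (vertex j) (outside j (inj₁ j<a))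
    back≡ : back f ≡ back f′
    back≡ = tabulateFrom-cong f f′ (a + k) rest λ j a+k≤j _ → cong (vertex j) (outside j (inj₂ a+k≤j))

  -- Connectivity

  update-valid : ∀ σ g l → ValidBlocks σ → admissible g l ≡ true →
                 (∀ g′ → suc g′ ≡ g → compatible g′ (σ g′) l ≡ true) →
                 (suc g < blocks → compatible g l (σ (suc g)) ≡ true) → ValidBlocks (update σ g l)
  update-valid σ g l (adm , comp) adm-l left right = adm′ , comp′
    where
    adm′ : ∀ x → x < blocks → admissible x (update σ g l x) ≡ true
    adm′ x x<b with x ≟ g
    ... | yes refl = subst (λ y → admissible x y ≡ true) (sym (update-≡ σ g l)) adm-l
    ... | no x≢g   = subst (λ y → admissible x y ≡ true) (sym (update-≢ σ g l x≢g)) (adm x x<b)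
    comp′ : ∀ x → suc x < blocks → compatible x (update σ g l x) (update σ g l (suc x)) ≡ true
    comp′ x sx<b with x ≟ g
    ... | yes refl = subst₂ (λ y z → compatible x y z ≡ true)
                       (sym (update-≡ σ g l)) (sym (update-≢ σ g l 1+n≢n)) (right sx<b)
    ... | no x≢g with suc x ≟ g
    ...   | yes refl = subst₂ (λ y z → compatible x y z ≡ true)
                         (sym (update-≢ σ g l x≢g)) (sym (update-≡ σ g l)) (left x refl)
    ...   | no sx≢g  = subst₂ (λ y z → compatible x y z ≡ true)
                         (sym (update-≢ σ g l x≢g)) (sym (update-≢ σ g l sx≢g)) (comp x sx<b)

  record Move (σ : ℕ → ℕ) (g l : ℕ) : Set where
    field
      valid     : ValidBlocks (update σ g l)
      reachable : Reachable (blockPath σ) (blockPath (update σ g l))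

  move : ∀ σ g l → ValidBlocks σ → g < blocks → admissible g l ≡ true →
         (∀ g′ → suc g′ ≡ g → compatible g′ (σ g′) l ≡ true) →
         (suc g < blocks → compatible g l (σ (suc g)) ≡ true) → Move σ g l
  move σ g l vσ g<b adm-l left right = record
    { valid     = valid
    ; reachable = reachable-single-block vσ valid g<b λ x x≢g → sym (update-≢ σ g l x≢g) }
    where valid = update-valid σ g l vσ adm-l left right

  double<blocks : ∀ {i} → i ≤ h → double i < blocks
  double<blocks i≤h = s≤s (double-mono-≤ i≤h)

  state-at : ∀ σ i → ValidBlocks σ → i ≤ h → isState (σ (double i)) ≡ true
  state-at σ i (adm , _) i≤h =
    trans (sym (admissible-even {double i} {σ (double i)} (even-double i))) (adm (double i) (double<blocks i≤h))

  connector-at : ∀ σ i → ValidBlocks σ → i < h → isConnector (σ (suc (double i))) ≡ true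
  connector-at σ i (adm , _) i<h =
    trans (sym (admissible-odd {suc (double i)} {σ (suc (double i))} (even-suc-double i)))
          (adm (suc (double i)) (<-trans (n<1+n _) (double<blocks i<h)))

  RightFree : (ℕ → ℕ) → ℕ → Set
  RightFree σ i = i < h → ∀ x → isState x ≡ true → compatible (double i) x (σ (suc (double i))) ≡ true

  <h-from-blocks : ∀ i → suc (double i) < blocks → i < h
  <h-from-blocks i sd<b = lemma i h (s≤s⁻¹ sd<b)
    where
    lemma : ∀ i h → suc (double i) ≤ double h → i < h
    lemma i       zero    ()
    lemma zero    (suc h) _       = z<s
    lemma (suc i) (suc h) (s≤s p) = s≤s (lemma i h (≤-pred p))

  state-left-compatible : ∀ σ i v → ValidBlocks σ → i ≤ h → isState v ≡ true →
                          (∀ {i′} → i ≡ suc i′ → rightOK (σ (suc (double i′))) v ≡ true) →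
                          ∀ g′ → suc g′ ≡ double i → compatible g′ (σ g′) v ≡ true
  state-left-compatible σ (suc i′) v vσ i≤h sv left-ok g′ refl =
    compatible-odd⁺ (suc (double i′)) (σ (suc (double i′))) v (even-suc-double i′) (connector-at σ i′ vσ i≤h) (left-ok refl) sv

  set-state : ∀ σ i v → ValidBlocks σ → i ≤ h → isState v ≡ true →
              (∀ {i′} → i ≡ suc i′ → rightOK (σ (suc (double i′))) v ≡ true) → RightFree σ i →
              Move σ (double i) v
  set-state σ i v vσ i≤h sv left-ok free =
    move σ (double i) v vσ (double<blocks i≤h) (trans (admissible-even {double i} {v} (even-double i)) sv) left right
    where
    left : ∀ g′ → suc g′ ≡ double i → compatible g′ (σ g′) v ≡ true
    left = state-left-compatible σ i v vσ i≤h sv left-ok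
    right : suc (double i) < blocks → compatible (double i) v (σ (suc (double i))) ≡ true
    right sd<b = free (<h-from-blocks i sd<b) v sv

  set-connector : ∀ σ i x → ValidBlocks σ → i < h → isConnector x ≡ true →
                  leftOK x (σ (double i)) ≡ true → rightOK x (σ (double (suc i))) ≡ true →
                  Move σ (suc (double i)) x
  set-connector σ i x vσ i<h cx lx rx =
    move σ (suc (double i)) x vσ (<-trans (n<1+n _) (double<blocks i<h))
      (trans (admissible-odd {suc (double i)} {x} (even-suc-double i)) cx) left right
    where
    left : ∀ g′ → suc g′ ≡ suc (double i) → compatible g′ (σ g′) x ≡ true
    left g′ refl = compatible-even⁺ (double i) (σ (double i)) x (even-double i) (state-at σ i vσ (<⇒≤ i<h)) lx cx
    right : suc (suc (double i)) < blocks → compatible (suc (double i)) x (σ (double (suc i))) ≡ true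
    right _ = compatible-odd⁺ (suc (double i)) x (σ (double (suc i))) (even-suc-double i) cx rx (state-at σ (suc i) vσ i<h)

  RightFree-cong : ∀ {σ σ′} i → σ′ (suc (double i)) ≡ σ (suc (double i)) → RightFree σ i → RightFree σ′ i
  RightFree-cong {σ} i eq free i<h x sx = subst (λ y → compatible (double i) x y ≡ true) (sym eq) (free i<h x sx)

  RightFree-pin : ∀ σ i a → isState a ≡ true → σ (suc (double i)) ≡ pin a → RightFree σ i
  RightFree-pin σ i a sa eq _ x sx = subst (λ y → compatible (double i) x y ≡ true) (sym eq)
    (compatible-even⁺ (double i) x (pin a) (even-double i) sx (trans (pin-leftOK a x sa) sx) (pin-isConnector a sa))

  record Retarget (σ : ℕ → ℕ) (i e : ℕ) : Set where
    field
      σ′        : ℕ → ℕ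
      valid     : ValidBlocks σ′
      reachable : Reachable (blockPath σ) (blockPath σ′)
      at        : σ′ (double i) ≡ e
      above     : ∀ g → double i < g → σ′ g ≡ σ g
      pinned    : ∀ {i′} → i ≡ suc i′ → σ′ (suc (double i′)) ≡ pin e

  module RetargetStep (i′ : ℕ) (i<h : suc i′ ≤ h)
    (retarget-below : ∀ σ e → ValidBlocks σ → RightFree σ i′ → isState e ≡ true → Retarget σ i′ e)
    (σ₀ : ℕ → ℕ) (free₀ : RightFree σ₀ (suc i′)) where

    left conn here : ℕ
    left = double i′
    conn = suc left
    here = suc conn

    record Pinned (σ : ℕ → ℕ) (a : ℕ) : Set where
      field
        valid     : ValidBlocks σ
        reachable : Reachable (blockPath σ₀) (blockPath σ)
        at        : σ here ≡ a
        pinned    : σ conn ≡ pin a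
        above     : ∀ g → here < g → σ g ≡ σ₀ g

    -- Move the state in block `here` from u to v across the hinge b: first bring the state on the
    -- left to hingeLeft b (recursively), then swap the pin for the hinge, move, and pin again.
    hinge-step : ∀ {σ} b u v → b < 3 → Pinned σ u → rightOK (hinge b) u ≡ true → rightOK (hinge b) v ≡ true →
                 isState v ≡ true → Σ (ℕ → ℕ) λ σ′ → Pinned σ′ v
    hinge-step {σ} b u v b<3 p ru rv sv = σ₅ , record
      { valid     = Move.valid m₅
      ; reachable = Reachable-trans (Pinned.reachable p) (Reachable-trans (Retarget.reachable r₂)
                      (Reachable-trans (Move.reachable m₃) (Reachable-trans (Move.reachable m₄) (Move.reachable m₅))))
      ; at        = trans (update-≢ σ₄ conn (pin v) 1+n≢n) (update-≡ σ₃ here v)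
      ; pinned    = update-≡ σ₄ conn (pin v)
      ; above     = λ g here<g → trans (update-above σ₄ conn (pin v) (<-trans (n<1+n conn) here<g))
                                   (trans (update-above σ₃ here v here<g) (above₃ g here<g)) }
      where
      su : isState u ≡ true
      su = subst (λ x → isState x ≡ true) (Pinned.at p) (state-at σ (suc i′) (Pinned.valid p) i<h)
      r₂ : Retarget σ i′ (hingeLeft b)
      r₂ = retarget-below σ (hingeLeft b) (Pinned.valid p) (RightFree-pin σ i′ u su (Pinned.pinned p))
             (isState-hingeLeft b)
      σ₂ σ₃ σ₄ σ₅ : ℕ → ℕ
      σ₂ = Retarget.σ′ r₂
      σ₃ = update σ₂ conn (hinge b)
      σ₄ = update σ₃ here v
      σ₅ = update σ₄ conn (pin v)
      above₂ : ∀ g → conn < g → σ₂ g ≡ σ g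
      above₂ g conn<g = Retarget.above r₂ g (<-trans (n<1+n left) conn<g)
      above₃ : ∀ g → here < g → σ₃ g ≡ σ₀ g
      above₃ g here<g = begin
        σ₃ g ≡⟨ update-above σ₂ conn (hinge b) conn<g ⟩
        σ₂ g ≡⟨ above₂ g conn<g ⟩
        σ g  ≡⟨ Pinned.above p g here<g ⟩
        σ₀ g ∎
        where
        open ≡-Reasoning
        conn<g = <-trans (n<1+n conn) here<g
      m₃ : Move σ₂ conn (hinge b)
      m₃ = set-connector σ₂ i′ (hinge b) (Retarget.valid r₂) i<h (hinge-isConnector b b<3)
             (subst (λ x → leftOK (hinge b) x ≡ true) (sym (Retarget.at r₂)) (hinge-leftOK b b<3))
             (subst (λ x → rightOK (hinge b) x ≡ true) (sym (trans (above₂ here (n<1+n conn)) (Pinned.at p))) ru)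
      m₄ : Move σ₃ here v
      m₄ = set-state σ₃ (suc i′) v (Move.valid m₃) i<h sv
             (λ { refl → subst (λ x → rightOK x v ≡ true) (sym (update-≡ σ₂ conn (hinge b))) rv })
             (RightFree-cong {σ₀} {σ₃} (suc i′) (above₃ (suc here) (n<1+n here)) free₀)
      m₅ : Move σ₄ conn (pin v)
      m₅ = set-connector σ₄ i′ (pin v) (Move.valid m₄) i<h (pin-isConnector v sv)
             (trans (pin-leftOK v (σ₄ left) sv) (state-at σ₄ i′ (Move.valid m₄) (<⇒≤ i<h)))
             (subst (λ x → rightOK (pin v) x ≡ true) (sym (update-≡ σ₃ here v)) (pin-rightOK v sv))

    climb : ∀ d {σ} a → a + d ≤ 3 → Pinned σ a → Σ (ℕ → ℕ) λ σ′ → Pinned σ′ (a + d)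
    climb zero    {σ} a _     p = σ , subst (Pinned σ) (sym (+-identityʳ a)) p
    climb (suc d)     a a+d≤3 p = proj₁ rest , subst (Pinned (proj₁ rest)) (sym (+-suc a d)) (proj₂ rest)
      where
      a<3 = <-≤-trans (s≤s (m≤m+n a d)) (subst (_≤ 3) (+-suc a d) a+d≤3)
      up = hinge-step a a (suc a) a<3 p (proj₁ (hinge-rightOK a a<3)) (proj₂ (hinge-rightOK a a<3))
             (isState⁺ (s≤s a<3))
      rest = climb d (suc a) (subst (_≤ 3) (+-suc a d) a+d≤3) (proj₂ up)

    descend : ∀ d {σ} e → e + d ≤ 3 → Pinned σ (e + d) → Σ (ℕ → ℕ) λ σ′ → Pinned σ′ e
    descend zero    {σ} e _     p = σ , subst (Pinned σ) (+-identityʳ e) p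
    descend (suc d) {σ} e e+d≤3 p = descend d e (≤-trans (+-monoʳ-≤ e (n≤1+n d)) e+d≤3) (proj₂ down)
      where
      e+d<3 = subst (_≤ 3) (+-suc e d) e+d≤3
      down = hinge-step (e + d) (suc (e + d)) (e + d) e+d<3 (subst (Pinned σ) (+-suc e d) p)
               (proj₂ (hinge-rightOK (e + d) e+d<3)) (proj₁ (hinge-rightOK (e + d) e+d<3))
               (isState⁺ (<-trans e+d<3 (n<1+n 3)))

    retarget-step : ∀ e → isState e ≡ true → ValidBlocks σ₀ → Retarget σ₀ (suc i′) e
    retarget-step e se vσ₀ = record
      { σ′ = proj₁ shifted ; valid = Pinned.valid p ; reachable = Pinned.reachable p
      ; at = Pinned.at p ; above = Pinned.above p ; pinned = λ { refl → Pinned.pinned p } }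
      where
      a₀ = σ₀ here
      σ₁ = update σ₀ conn (pin a₀)
      sa₀ : isState a₀ ≡ true
      sa₀ = state-at σ₀ (suc i′) vσ₀ i<h
      m₁ : Move σ₀ conn (pin a₀)
      m₁ = set-connector σ₀ i′ (pin a₀) vσ₀ i<h (pin-isConnector a₀ sa₀)
             (trans (pin-leftOK a₀ (σ₀ left) sa₀) (state-at σ₀ i′ vσ₀ (<⇒≤ i<h))) (pin-rightOK a₀ sa₀)
      p₁ : Pinned σ₁ a₀
      p₁ = record { valid = Move.valid m₁ ; reachable = Move.reachable m₁
                  ; at = update-≢ σ₀ conn (pin a₀) 1+n≢n ; pinned = update-≡ σ₀ conn (pin a₀)
                  ; above = λ g here<g → update-above σ₀ conn (pin a₀) (<-trans (n<1+n conn) here<g) }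
      shift : a₀ ≤ e ⊎ e ≤ a₀ → Σ (ℕ → ℕ) λ σ′ → Pinned σ′ e
      shift (inj₁ a₀≤e) = proj₁ up , subst (Pinned (proj₁ up)) (m+[n∸m]≡n a₀≤e) (proj₂ up)
        where up = climb (e ∸ a₀) a₀ (subst (_≤ 3) (sym (m+[n∸m]≡n a₀≤e)) (s≤s⁻¹ (isState-< se))) p₁
      shift (inj₂ e≤a₀) = descend (a₀ ∸ e) e (subst (_≤ 3) (sym (m+[n∸m]≡n e≤a₀)) (s≤s⁻¹ (isState-< sa₀)))
                            (subst (Pinned σ₁) (sym (m+[n∸m]≡n e≤a₀)) p₁)
      shifted = shift (≤-total a₀ e)
      p = proj₂ shifted

  retarget : ∀ i → i ≤ h → ∀ σ e → ValidBlocks σ → RightFree σ i → isState e ≡ true → Retarget σ i e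
  retarget zero i≤h σ e vσ free se = record
    { σ′ = update σ 0 e ; valid = Move.valid m ; reachable = Move.reachable m ; at = update-≡ σ 0 e
    ; above = λ g 0<g → update-above σ 0 e 0<g ; pinned = λ () }
    where m = set-state σ 0 e vσ i≤h se (λ ()) free
  retarget (suc i′) i≤h σ e vσ free se =
    RetargetStep.retarget-step i′ i≤h (retarget i′ (≤-trans (n≤1+n i′) i≤h)) σ free e se vσ

  uniform-even : ∀ a i → uniform a (double i) ≡ a
  uniform-even a i = if-true (even-double i)

  uniform-odd : ∀ a i → uniform a (suc (double i)) ≡ pin a
  uniform-odd a i = if-false (even-suc-double i)

  record Canonical (σ : ℕ → ℕ) : Set where
    field
      σ′        : ℕ → ℕ
      reachable : Reachable (blockPath σ) (blockPath σ′)
      canonical : ∀ g → g < blocks → σ′ g ≡ uniform 0 g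

  -- Set the state blocks 2i, 2i − 2, …, 0 to 0 in turn; each retargeting pins the connector on its
  -- left to pin 0, which frees the next state.
  canonicalise : ∀ i → i ≤ h → ∀ σ → ValidBlocks σ → RightFree σ i →
                 (∀ g → double i < g → g < blocks → σ g ≡ uniform 0 g) → Canonical σ
  canonicalise zero i≤h σ vσ free done = record
    { σ′ = Retarget.σ′ r ; reachable = Retarget.reachable r ; canonical = canonical }
    where
    r : Retarget σ 0 0
    r = retarget zero i≤h σ 0 vσ free refl
    canonical : ∀ g → g < blocks → Retarget.σ′ r g ≡ uniform 0 g
    canonical zero    _   = Retarget.at r
    canonical (suc g) g<b = trans (Retarget.above r (suc g) z<s) (done (suc g) z<s g<b)
  canonicalise (suc i) i≤h σ vσ free done = record
    { σ′ = Canonical.σ′ rest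
    ; reachable = Reachable-trans (Retarget.reachable r) (Canonical.reachable rest)
    ; canonical = Canonical.canonical rest }
    where
    r : Retarget σ (suc i) 0
    r = retarget (suc i) i≤h σ 0 vσ free refl
    σ₁ : ℕ → ℕ
    σ₁ = Retarget.σ′ r
    done₁ : ∀ g → double i < g → g < blocks → σ₁ g ≡ uniform 0 g
    done₁ g i<g g<b with suc (double i) ≟ g
    ... | yes refl = trans (Retarget.pinned r refl) (sym (uniform-odd 0 i))
    ... | no ≢g with double (suc i) ≟ g
    ...   | yes refl = trans (Retarget.at r) (sym (uniform-even 0 (suc i)))
    ...   | no ≢g′ = trans (Retarget.above r g beyond) (done g beyond g<b)
      where beyond = ≤∧≢⇒< (≤∧≢⇒< i<g ≢g) ≢g′
    rest : Canonical σ₁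
    rest = canonicalise i (≤-trans (n≤1+n i) i≤h) σ₁ (Retarget.valid r)
             (RightFree-pin σ₁ i 0 refl (Retarget.pinned r refl)) done₁

  reach-uniform : ∀ P → IsShortestPath G source target P → Reachable P (blockPath (uniform 0))
  reach-uniform P sp = subst₂ Reachable (sym (proj₁ decoded))
    (blockPath-cong (Canonical.canonical c)) (Canonical.reachable c)
    where
    decoded = decode P sp
    c : Canonical (blocksOf P)
    c = canonicalise h ≤-refl (blocksOf P) (proj₂ decoded) (λ h<h → ⊥-elim (<-irrefl refl h<h))
          (λ g h<g g<b → ⊥-elim (<-irrefl refl (<-≤-trans h<g (s≤s⁻¹ g<b))))

  connected : SPRConnected G source target k
  connected P Q spP spQ = Reachable-trans (reach-uniform P spP) (Reachable-sym (reach-uniform Q spQ))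

  -- The lower bound

  state : List (Fin n) → ℕ → ℕ
  state P i = blocksOf P (double i)

  -- When a step changes the state i + 1, the connector between the states i and i + 1 is unchanged,
  -- so it has to accept both values of state i + 1 on its right and both values of state i on its left.
  record Hinged (P Q : List (Fin n)) (i : ℕ) : Set where
    field
      connector : ℕ
      rightP    : rightOK connector (state P (suc i)) ≡ true
      rightQ    : rightOK connector (state Q (suc i)) ≡ true
      leftP     : leftOK connector (state P i) ≡ true
      leftQ     : leftOK connector (state Q i) ≡ true

  hinged : ∀ {P Q} i → suc i ≤ h → SPRAdj G source target k P Q → state P (suc i) ≢ state Q (suc i) → Hinged P Q i
  hinged {P} {Q} i i<h adjPQ differ = record
    { connector = blocksOf P c
    ; rightP    = right P (proj₂ (decode P spP))
    ; rightQ    = subst (λ x → rightOK x (state Q (suc i)) ≡ true) (sym unchanged) (right Q (proj₂ (decode Q spQ)))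
    ; leftP     = left P (proj₂ (decode P spP))
    ; leftQ     = subst (λ x → leftOK x (state Q i) ≡ true) (sym unchanged) (left Q (proj₂ (decode Q spQ))) }
    where
    spP = proj₁ adjPQ
    spQ = proj₁ (proj₂ adjPQ)
    c = suc (double i)
    c<b : c < blocks
    c<b = <-trans (n<1+n c) (double<blocks i<h)
    unchanged : blocksOf P c ≡ blocksOf Q c
    unchanged = one-block-changes adjPQ (double<blocks i<h) c<b differ (<⇒≢ (n<1+n c))
    right : ∀ X → ValidBlocks (blocksOf X) → rightOK (blocksOf X c) (state X (suc i)) ≡ true
    right X (_ , comp) = proj₁ (proj₂ (compatible-odd⁻ c {blocksOf X c} {state X (suc i)}
                                        (even-suc-double i) (comp c (double<blocks i<h))))
    left : ∀ X → ValidBlocks (blocksOf X) → leftOK (blocksOf X c) (state X i) ≡ true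
    left X (_ , comp) = proj₁ (proj₂ (compatible-even⁻ (double i) {state X i} {blocksOf X c}
                                       (even-double i) (comp (double i) c<b)))

  record HingeCrossing (P Q : List (Fin n)) (i t : ℕ) : Set where
    field
      fromP : state P (suc i) ≡ pred t
      toQ   : state Q (suc i) ≡ t
      leftP : state P i ≡ hingeLeft (pred t)
      leftQ : state Q i ≡ hingeLeft (pred t)

  hinge-crossing-step : ∀ t i → suc i ≤ h → ∀ {P Q} → SPRAdj G source target k P Q →
                        ¬ (t ≤ state P (suc i)) → t ≤ state Q (suc i) → HingeCrossing P Q i t
  hinge-crossing-step t i i<h {P} {Q} adjPQ below above = record
    { fromP = proj₁ atP ; toQ = proj₁ (proj₂ atP) ; leftP = proj₂ (proj₂ atP) ; leftQ = proj₂ (proj₂ atQ) }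
    where
    H : Hinged P Q i
    H = hinged i i<h adjPQ (λ eq → below (subst (t ≤_) (sym eq) above))
    open Hinged H
    atP = hinge-crossing t connector (≰⇒> below) above rightP rightQ leftP
    atQ = hinge-crossing t connector (≰⇒> below) above rightP rightQ leftQ

  flip-cost : ∀ i → i ≤ h → ∀ {P Q m} → SPRWalk G source target k P Q m → state P i ≡ 0 → state Q i ≡ 3 → 2 ^ i ≤ m
  flip-cost zero _ (walk-refl _ _) s₀ s₃ with () ← trans (sym s₀) s₃
  flip-cost zero _ (walk-step _ _ _ _ _ _) _ _ = s≤s z≤n
  flip-cost (suc i) i<h {P} {Q} {m} w P≡0 Q≡3 = begin
    2 ^ suc i                 ≡⟨ cong (2 ^ i +_) (+-identityʳ (2 ^ i)) ⟩
    2 ^ i + 2 ^ i             ≤⟨ +-mono-≤ first-half (≤-trans second-half (n≤1+n _)) ⟩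
    m₁ + suc m₂               ≡⟨ sym m≡ ⟩
    m                         ∎
    where
    open ≤-Reasoning
    ih : ∀ {X Y m′} → SPRWalk G source target k X Y m′ → state X i ≡ 0 → state Y i ≡ 3 → 2 ^ i ≤ m′
    ih = flip-cost i (≤-trans (n≤1+n i) i<h)
    cross : ∀ t {X Y m} → SPRWalk G source target k X Y m → ¬ (t ≤ state X (suc i)) → t ≤ state Y (suc i) →
            Crossing (λ Z → t ≤ state Z (suc i)) X Y m
    cross t = first-crossing (λ Z → t ≤? state Z (suc i))
    below : ∀ X {t v} → state X (suc i) ≡ v → v < t → ¬ (t ≤ state X (suc i))
    below X eq v<t t≤ = <⇒≱ v<t (subst (_ ≤_) eq t≤)
    middle : Crossing (λ Z → 2 ≤ state Z (suc i)) P Q m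
    middle = cross 2 w (below P P≡0 (s≤s z≤n)) (subst (2 ≤_) (sym Q≡3) (s≤s (s≤s z≤n)))
    open Crossing middle
    hinge₁ : HingeCrossing before after i 2
    hinge₁ = hinge-crossing-step 2 i i<h edge ¬X-before X-after
    first : Crossing (λ Z → 1 ≤ state Z (suc i)) P before m₁
    first = cross 1 walk₁ (below P P≡0 (s≤s z≤n)) (subst (1 ≤_) (sym (HingeCrossing.fromP hinge₁)) (s≤s z≤n))
    hinge₀ : HingeCrossing (Crossing.before first) (Crossing.after first) i 1
    hinge₀ = hinge-crossing-step 1 i i<h (Crossing.edge first) (Crossing.¬X-before first) (Crossing.X-after first)
    first-half : 2 ^ i ≤ m₁
    first-half = ≤-trans (ih (SPRWalk-reverse (Crossing.walk₂ first)) (HingeCrossing.leftP hinge₁) (HingeCrossing.leftQ hinge₀))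
                         (subst (Crossing.m₂ first ≤_) (sym (Crossing.m≡ first)) (≤-trans (n≤1+n _) (m≤n+m _ _)))
    last : Crossing (λ Z → 3 ≤ state Z (suc i)) after Q m₂
    last = cross 3 walk₂ (below after (HingeCrossing.toQ hinge₁) ≤-refl) (subst (3 ≤_) (sym Q≡3) ≤-refl)
    hinge₂ : HingeCrossing (Crossing.before last) (Crossing.after last) i 3
    hinge₂ = hinge-crossing-step 3 i i<h (Crossing.edge last) (Crossing.¬X-before last) (Crossing.X-after last)
    second-half : 2 ^ i ≤ m₂
    second-half = ≤-trans (ih (Crossing.walk₁ last) (HingeCrossing.leftQ hinge₁) (HingeCrossing.leftP hinge₂))
                          (subst (Crossing.m₁ last ≤_) (sym (Crossing.m≡ last)) (m≤m+n _ _))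

  state-uniform : ∀ a → isState a ≡ true → ∀ i → i ≤ h → state (blockPath (uniform a)) i ≡ a
  state-uniform a sa i i≤h = trans (blocksOf-blockPath (uniform a) (uniform-valid a sa) (double i) (double<blocks i≤h))
                                   (uniform-even a i)

  uniform-0-3-walk-length : ∀ m → SPRWalk G source target k (blockPath (uniform 0)) (blockPath (uniform 3)) m → 2 ^ h ≤ m
  uniform-0-3-walk-length m w = flip-cost h ≤-refl w (state-uniform 0 refl h ≤-refl) (state-uniform 3 refl h ≤-refl)

-- Choice of parameters

-- Written with 2 + h for h so that the slack on the right has natural-number coefficients.
room-identity : ∀ h k′ → (2 + h) * (44 * suc k′) ≡
                suc (suc (suc ((2 + h) + (2 + h)) * suc k′)) * 11 + (22 * h * k′ + 22 * h + 33 * k′ + 11)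
room-identity = solve-∀

quotient-bound : ∀ n d .{{_ : NonZero d}} → 2 * d ≤ n → 2 ≤ n / d × n ≤ (n / d) * (2 * d)
quotient-bound n d 2d≤n = 2≤q , (begin
  n                   ≡⟨ m≡m%n+[m/n]*n n d ⟩
  n % d + q * d       ≤⟨ +-monoˡ-≤ (q * d) (<⇒≤ (m%n<n n d)) ⟩
  d + q * d           ≤⟨ +-monoˡ-≤ (q * d) (subst (_≤ q * d) (*-identityˡ d) (*-monoˡ-≤ d (≤-trans (s≤s z≤n) 2≤q))) ⟩
  q * d + q * d       ≡⟨ double-product q d ⟩
  q * (2 * d)         ∎)
  where
  open ≤-Reasoning
  q = n / d
  2≤q : 2 ≤ q
  2≤q = subst (_≤ q) (m*n/n≡m 2 d) (/-monoˡ-≤ d 2d≤n)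
  double-product : ∀ q d → q * d + q * d ≡ q * (2 * d)
  double-product = solve-∀

room-bound : ∀ h k′ → 2 ≤ h → suc (suc (depth k′ h)) * width ≤ h * (44 * suc k′)
room-bound (suc (suc h″)) k′ (s≤s (s≤s z≤n)) = begin
  suc (suc (depth k′ (2 + h″))) * width                         ≡⟨ cong (λ x → suc (suc (suc x * suc k′)) * width) (double≡+ (2 + h″)) ⟩
  suc (suc (suc ((2 + h″) + (2 + h″)) * suc k′)) * 11           ≤⟨ m≤m+n _ _ ⟩
  suc (suc (suc ((2 + h″) + (2 + h″)) * suc k′)) * 11 + (22 * h″ * k′ + 22 * h″ + 33 * k′ + 11) ≡⟨ sym (room-identity h″ k′) ⟩
  (2 + h″) * (44 * suc k′)                                      ∎
  where open ≤-Reasoning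

exponential-instance : ∀ k′ n → 88 * suc k′ ≤ n →
  ∃[ G ] ∃[ s ] ∃[ t ] (SPRConnected {n} G s t (suc k′) ×
    ∃[ P ] ∃[ Q ] (IsShortestPath G s t P × IsShortestPath G s t Q ×
      (∀ m → SPRWalk G s t (suc k′) P Q m → 2 ^ (1 * n) ≤ m ^ (88 * suc k′))))
exponential-instance k′ n 88k≤n =
  graph n , source , target , connected , P , Q , spP , spQ , λ m w → begin
    2 ^ (1 * n)               ≡⟨ cong (2 ^_) (*-identityˡ n) ⟩
    2 ^ n                     ≤⟨ ^-monoʳ-≤ 2 n≤ ⟩
    2 ^ (h * (88 * suc k′))   ≡⟨ sym (^-*-assoc 2 h (88 * suc k′)) ⟩
    (2 ^ h) ^ (88 * suc k′)   ≤⟨ ^-monoˡ-≤ (88 * suc k′) (uniform-0-3-walk-length m w) ⟩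
    m ^ (88 * suc k′)         ∎
  where
  open ≤-Reasoning
  d h : ℕ
  d = 44 * suc k′
  h = n / d
  2d≡ : 2 * d ≡ 88 * suc k′
  2d≡ = sym (*-assoc 2 44 (suc k′))
  quotient : 2 ≤ h × n ≤ h * (2 * d)
  quotient = quotient-bound n d (subst (_≤ n) (sym 2d≡) 88k≤n)
  n≤ : n ≤ h * (88 * suc k′)
  n≤ = subst (λ x → n ≤ h * x) 2d≡ (proj₂ quotient)
  room : suc (suc (depth k′ h)) * width ≤ n
  room = ≤-trans (room-bound h k′ (proj₁ quotient)) (m/n*n≤m n d)
  open Construction k′ h n room
  P Q : List (Fin n)
  P = blockPath (uniform 0)
  Q = blockPath (uniform 3)
  spP : IsShortestPath (graph n) source target P
  spP = blockPath-shortest (uniform 0) (uniform-valid 0 refl)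
  spQ : IsShortestPath (graph n) source target Q
  spQ = blockPath-shortest (uniform 3) (uniform-valid 3 refl)

mainTheorem9 : ∃[ p ] ∃[ q ] ((1 ≤ p) × (1 ≤ q) ×
    (∀ k → 1 ≤ k → ∃[ N ] (∀ n → N ≤ n →
    ∃[ G ] ∃[ s ] ∃[ t ]
    (SPRConnected {n} G s t k ×
    ∃[ P ] ∃[ Q ] (IsShortestPath G s t P × IsShortestPath G s t Q ×
    (∀ m → SPRWalk G s t k P Q m → 2 ^ (p * n) ≤ m ^ (q * k)))))))
mainTheorem9 = 1 , 88 , s≤s z≤n , s≤s z≤n ,
  λ { (suc k′) _ → 88 * suc k′ , exponential-instance k′ }
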